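{- Let $G$ be an irreflexive graph and let $G^{\#}$ with subgraph $T^*$ be as constructed in the context. There is a homomorphism $\phi:G\to K_3$ if and only if there is a homomorphism $\phi^*:G^{\#}\to H$ such that $[\phi^*(Z^*)]=[C]$ for some copy $C$ of $Z$ in $H$. Moreover, if there is such a homomorphism $\phi^*$, it may be chosen to be constant $0$ on $T^*$.
   Context: All graphs in the construction are reflexive. $H$ is a connected triangle-free reflexive graph with non-trivial first homology $H_1(\mathbf{H})$ of its clique complex (simplices: ordered tuples of pairwise equal-or-adjacent vertices; integer chains; alternating-sum boundary; closed walks identified with the 1-cycle of consecutive edges), and $Z=(0,1,\dots,g-1,0)$, $g\ge4$, a fixed shortest homologically non-trivial cycle of $H$; a "copy of $Z$" is a cycle of length $g$ with vertices labelled $0,\dots,g-1$ in cyclic order, oriented by the labels. Sum gadget $S_s$ ($s\ge2$): with $B$ the reflexive cycle $0,1,\dots,sg-1$, $\beta(js+i)=j$, $\alpha_k(ig+j)=j$ if $i=k$ else $0$, fix $\ell\ge2$ such that for every $i\in[s]$ there is a homomorphism $P_\ell\times B\to Z$ equal to $\alpha_i$ on slice $0\times B$, to $\beta$ on slice $\ell\times B$, and $0$ on $P_\ell\times\{0\}$ ($P_\ell$ the reflexive path $0..\ell$, $\times$ the categorical product). From $P_\ell\times B$: identify $(\ell,js+i)$ over $i\in[s]$ for each $j$ (giving a copy $Z$ with label $j$); identify $(0,ig)$ over $i\in[s]$ (giving copies $A_i'$ with $(0,ig+j)$ labelled $j$); for each $i$ attach a new $P_1\times Z$ with one slice identified with $A_i'$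 and the other slice called $A_i$. $T(S_s)$: the subgraph induced by images of $(j,0)$, $0\le j\le\ell$, and vertex $0$ of each $A_i$. Construction of $G^{\#}$: (1) for each $v\in V(G)$ disjoint copies $A_0^v,A_1^v,A_2^v$ of $Z$, and a further copy $Z^*$; (2) for each $v$ a new copy $S^v$ of $S_3$, identify its $Z$ with $Z^*$ and its $A_i$ with $A_i^v$ (label-preserving); (3) for each $v$ and $i<j$ in $[3]$ a new copy $S^v_{i,j}$ of $S_2$, identify its $A_0$ with $A^v_i$ (label-preserving) and its $A_1$ with $A^v_j$, the vertex labelled $k$ in $A_1$ going to the vertex labelled $-k \bmod g$ in $A^v_j$; (4) for each edge $uv$ of $G$ and $i\in[3]$ a new copy $S_i^{uv}$ of $S_2$, identify its $A_0$ with $A_i^u$ and its $A_1$ with $A_i^v$ (label-preserving). $T^*$ is the union of the subgraphs $T(S)$ over all gadgets $S$ used. -}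

module Defs where

open import Data.Nat as ℕ using (ℕ; zero; suc; _+_; _*_; _≤_)
open import Data.Fin as Fin using (Fin; toℕ; fromℕ; fromℕ<; opposite)
open import Data.Integer as ℤ using (ℤ)
open import Data.Bool using (Bool; true; false; T)
open import Data.Product using (Σ; ∃; _×_; _,_; proj₂)
open import Data.Sum using (_⊎_)
open import Data.List using (List; []; _∷_; map; foldr)
open import Data.List.Relation.Unary.All using (All)
open import Relation.Binary.PropositionalEquality using (_≡_; _≢_)
open import Relation.Nullary using (¬_; yes; no)
open import Function using (_∘_)

next : ∀ {n} → Fin n → Fin n
next {suc n} a with suc (toℕ a) ℕ.<? suc n
... | yes p = fromℕ< p
... | no _  = Fin.zero

-- negation modulo n :  k ↦ (-k) mod n
neg : ∀ {n} → Fin n → Fin n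
neg = next ∘ opposite

CycAdj : ∀ {n} → Fin n → Fin n → Set
CycAdj {n} a b = toℕ a ≡ toℕ b ⊎ suc (toℕ a) ≡ toℕ b ⊎ suc (toℕ b) ≡ toℕ a
                 ⊎ (suc (toℕ a) ≡ n × toℕ b ≡ 0) ⊎ (suc (toℕ b) ≡ n × toℕ a ≡ 0)

PathAdj : ∀ {k} → Fin k → Fin k → Set
PathAdj a b = toℕ a ≡ toℕ b ⊎ suc (toℕ a) ≡ toℕ b ⊎ suc (toℕ b) ≡ toℕ a

record FGraph : Set₁ where
  field
    m   : ℕ
    Adj : Fin m → Fin m → Set
    sym : ∀ {a b} → Adj a b → Adj b a
open FGraph public

Reflexive : FGraph → Set
Reflexive H = ∀ a → Adj H a a

data Reach (H : FGraph) : Fin (m H) → Fin (m H) → Set where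
  here : ∀ {a} → Reach H a a
  step : ∀ {a b c} → Adj H a b → Reach H b c → Reach H a c

Connected : FGraph → Set
Connected H = ∀ a b → Reach H a b

TriangleFree : FGraph → Set
TriangleFree H = ∀ a b c → a ≢ b → b ≢ c → a ≢ c →
  Adj H a b → Adj H b c → Adj H a c → ⊥'
  where open import Data.Empty renaming (⊥ to ⊥')

ClosedWalk : (H : FGraph) {k : ℕ} → (Fin k → Fin (m H)) → Set
ClosedWalk H w = ∀ i → Adj H (w i) (w (next i))

IsCycle : (H : FGraph) {k : ℕ} → (Fin k → Fin (m H)) → Set
IsCycle H w = ClosedWalk H w × (∀ i j → w i ≡ w j → i ≡ j)

record SGraph : Set where
  field
    n      : ℕ
    adj    : Fin n → Fin n → Bool
    adjSym : ∀ u v → adj u v ≡ adj v u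
    irrefl : ∀ v → adj v v ≡ false
open SGraph public

K3Hom : (G : SGraph) → (Fin (n G) → Fin 3) → Set
K3Hom G φ = ∀ u v → T (adj G u v) → φ u ≢ φ v

-- Integer simplicial chains of the clique complex of H
-- (simplices = ordered tuples of pairwise equal-or-adjacent vertices)

module _ (H : FGraph) where

  EqOrAdj : Fin (m H) → Fin (m H) → Set
  EqOrAdj a b = a ≡ b ⊎ Adj H a b

  Chain₁ : Set
  Chain₁ = Fin (m H) → Fin (m H) → ℤ

  δ : Fin (m H) → Fin (m H) → Fin (m H) → Fin (m H) → ℤ
  δ a b x y with a Fin.≟ x | b Fin.≟ y
  ... | yes _ | yes _ = ℤ.1ℤ
  ... | _     | _     = ℤ.0ℤ

  sumℤ : List ℤ → ℤ
  sumℤ = foldr ℤ._+_ ℤ.0ℤ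

  walkChain : {k : ℕ} → (Fin k → Fin (m H)) → Chain₁
  walkChain {k} w a b = sumℤ (map (λ i → δ a b (w i) (w (next i))) (Data.List.allFin k))
    where import Data.List

  Simplex₂ : Set
  Simplex₂ = Fin (m H) × Fin (m H) × Fin (m H)

  ValidSimplex₂ : Simplex₂ → Set
  ValidSimplex₂ (x , y , z) = EqOrAdj x y × EqOrAdj y z × EqOrAdj x z

  Chain₂ : Set
  Chain₂ = List (ℤ × Simplex₂)

  ∂₂ : Chain₂ → Chain₁
  ∂₂ L a b = sumℤ (map (λ { (c , (x , y , z)) →
                 c ℤ.* ((δ a b y z ℤ.- δ a b x z) ℤ.+ δ a b x y) }) L)

  IsBoundary : Chain₁ → Set
  IsBoundary χ = Σ Chain₂ λ L → All (λ e → ValidSimplex₂ (proj₂ e)) L × (∀ a b → χ a b ≡ ∂₂ L a b)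

  NullHomologous : {k : ℕ} → (Fin k → Fin (m H)) → Set
  NullHomologous w = IsBoundary (walkChain w)

  Homologous : {k₁ k₂ : ℕ} → (Fin k₁ → Fin (m H)) → (Fin k₂ → Fin (m H)) → Set
  Homologous w₁ w₂ = IsBoundary (λ a b → walkChain w₁ a b ℤ.- walkChain w₂ a b)

  NoShorterNontrivial : ℕ → Set
  NoShorterNontrivial g = ∀ k (w : Fin k → Fin (m H)) →
    ClosedWalk H w → ¬ NullHomologous w → g ≤ k

-- The sum gadget S_s (with parameters g, ℓ), presented by generators:
-- vertices of P_ℓ × B and of the s attached copies of P_1 × Z,
-- identifications, and edges.

data SV (s g ℓ : ℕ) : Set where
  pb : Fin (suc ℓ) → Fin (s * g) → SV s g ℓ
  ax : Fin s → Fin 2 → Fin g → SV s g ℓ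

data SIdent {s g ℓ : ℕ} : SV s g ℓ → SV s g ℓ → Set where
  -- (ℓ, js+i) ~ (ℓ, js+i')   : vertex labelled j of the copy Z
  zid  : (j : Fin g) (i i' : Fin s) (b b' : Fin (s * g)) →
         toℕ b ≡ toℕ j * s + toℕ i → toℕ b' ≡ toℕ j * s + toℕ i' →
         SIdent (pb (fromℕ ℓ) b) (pb (fromℕ ℓ) b')
  aid  : (i i' : Fin s) (b b' : Fin (s * g)) →
         toℕ b ≡ toℕ i * g → toℕ b' ≡ toℕ i' * g →
         SIdent (pb Fin.zero b) (pb Fin.zero b')
  -- slice 0 of the i-th P_1 × Z glued label-preservingly to A_i'
  glue : (i : Fin s) (j : Fin g) (b : Fin (s * g)) →
         toℕ b ≡ toℕ i * g + toℕ j →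
         SIdent (ax i Fin.zero j) (pb Fin.zero b)

data SEdge {s g ℓ : ℕ} : SV s g ℓ → SV s g ℓ → Set where
  prodE : ∀ {p p' b b'} → PathAdj p p' → CycAdj b b' → SEdge (pb p b) (pb p' b')
  axE   : ∀ {i e e' j j'} → CycAdj j j' → SEdge (ax i e j) (ax i e' j')

data SZVertex {s g ℓ : ℕ} (j : Fin g) : SV s g ℓ → Set where
  zv : (i : Fin s) (b : Fin (s * g)) → toℕ b ≡ toℕ j * s + toℕ i →
       SZVertex j (pb (fromℕ ℓ) b)

aVert : ∀ {s g ℓ} → Fin s → Fin g → SV s g ℓ
aVert i j = ax i (Fin.suc Fin.zero) j

data InT {s g ℓ : ℕ} : SV s g ℓ → Set where
  tP : (p : Fin (suc ℓ)) (b : Fin (s * g)) → toℕ b ≡ 0 → InT (pb p b)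
  tA : (i : Fin s) (j : Fin g) → toℕ j ≡ 0 → InT (aVert i j)

ValidL : (s g ℓ : ℕ) → Set
ValidL s g ℓ = 2 ≤ ℓ × ∀ (k : Fin s) → Σ (Fin (suc ℓ) → Fin (s * g) → Fin g) λ h →
    (∀ p p' b b' → PathAdj p p' → CycAdj b b' → CycAdj (h p b) (h p' b'))
  × (∀ (i : Fin s) (j : Fin g) b → toℕ b ≡ toℕ i * g + toℕ j →
       (i ≡ k → toℕ (h Fin.zero b) ≡ toℕ j) × (i ≢ k → toℕ (h Fin.zero b) ≡ 0))
  × (∀ (j : Fin g) (i : Fin s) b → toℕ b ≡ toℕ j * s + toℕ i → toℕ (h (fromℕ ℓ) b) ≡ toℕ j)
  × (∀ p b → toℕ b ≡ 0 → toℕ (h p b) ≡ 0)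

module Sharp (G : SGraph) (g ℓ₂ ℓ₃ : ℕ) where

  private
    one : Fin 2
    one = Fin.suc Fin.zero

  data GV : Set where
    aV     : Fin (n G) → Fin 3 → Fin g → GV
    zV     : Fin g → GV
    s3V    : Fin (n G) → SV 3 g ℓ₃ → GV
    pairV  : (v : Fin (n G)) (i j : Fin 3) → i Fin.< j → SV 2 g ℓ₂ → GV
    edgeV  : (u v : Fin (n G)) → u Fin.< v → T (adj G u v) → Fin 3 → SV 2 g ℓ₂ → GV

  data GIdent : GV → GV → Set where
    inS3   : ∀ {v x y} → SIdent x y → GIdent (s3V v x) (s3V v y)
    inPair : ∀ {v i j p x y} → SIdent x y → GIdent (pairV v i j p x) (pairV v i j p y)
    inEdge : ∀ {u v p e i x y} → SIdent x y → GIdent (edgeV u v p e i x) (edgeV u v p e i y)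
    s3Z    : ∀ {v x} (j : Fin g) → SZVertex j x → GIdent (s3V v x) (zV j)
    s3A    : ∀ v (i : Fin 3) (j : Fin g) → GIdent (s3V v (aVert i j)) (aV v i j)
    pairA0 : ∀ v i j p (k : Fin g) → GIdent (pairV v i j p (aVert Fin.zero k)) (aV v i k)
    pairA1 : ∀ v i j p (k : Fin g) → GIdent (pairV v i j p (aVert one k)) (aV v j (neg k))
    edgeA0 : ∀ u v p e i (k : Fin g) → GIdent (edgeV u v p e i (aVert Fin.zero k)) (aV u i k)
    edgeA1 : ∀ u v p e i (k : Fin g) → GIdent (edgeV u v p e i (aVert one k)) (aV v i k)

  data GEdge : GV → GV → Set where
    aE     : ∀ {v i j j'} → CycAdj j j' → GEdge (aV v i j) (aV v i j')
    zE     : ∀ {j j'} → CycAdj j j' → GEdge (zV j) (zV j')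
    s3E    : ∀ {v x y} → SEdge x y → GEdge (s3V v x) (s3V v y)
    pairE  : ∀ {v i j p x y} → SEdge x y → GEdge (pairV v i j p x) (pairV v i j p y)
    edgeE  : ∀ {u v p e i x y} → SEdge x y → GEdge (edgeV u v p e i x) (edgeV u v p e i y)

  data InTStar : GV → Set where
    tS3   : ∀ {v x} → InT x → InTStar (s3V v x)
    tPair : ∀ {v i j p x} → InT x → InTStar (pairV v i j p x)
    tEdge : ∀ {u v p e i x} → InT x → InTStar (edgeV u v p e i x)

  IsHom : (H : FGraph) → (GV → Fin (m H)) → Set
  IsHom H f = (∀ x y → GIdent x y → f x ≡ f y) × (∀ x y → GEdge x y → Adj H (f x) (f y))

  imageZ* : (H : FGraph) → (GV → Fin (m H)) → Fin g → Fin (m H)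
  imageZ* H f j = f (zV j)

  HitsCopy : (H : FGraph) → (GV → Fin (m H)) → Set
  HitsCopy H f = Σ (Fin g → Fin (m H)) λ C → IsCycle H C × Homologous H (imageZ* H f) C

  ZeroOnT* : (H : FGraph) (z : Fin g → Fin (m H)) → (GV → Fin (m H)) → Set
  ZeroOnT* H z f = ∀ x → InTStar x → ∀ (j : Fin g) → toℕ j ≡ 0 → f x ≡ z j

module Submission where

-- A closed walk w in H is recorded by its flow: flow w a b counts the steps a → b minus the steps b → a.
-- As H is triangle-free, every 2-simplex of its clique complex is degenerate and boundaries have zero
-- flow, so flow is a homology invariant; likewise two closed walks joined by a strip of squares (the
-- slices of P_ℓ × B, the two ends of P_1 × Z) have the same flow. In a sum gadget this makes the flow of
-- Z the sum of the flows of the A_i.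
--
-- A closed walk of length g has energy Σ flow² equal to 2g if it is a cycle and 0 otherwise, because a
-- repeated vertex splits it into two shorter, hence null-homologous, closed walks. If φ* hits a copy C,
-- then Z* has energy 2g, flow(Z*) = Σᵢ flow(A^v_i), and by the pair gadgets every flow(A^v_i) − flow(A^v_j)
-- has energy 0 or 2g. The identity |P+Q+R|² + |P−Q|² + |P−R|² + |Q−R|² = 3(|P|² + |Q|² + |R|²) then
-- leaves exactly one A^v_i with non-zero flow, and that i is the colour of v. If both ends of an edge uv
-- had colour i, the gadget S^{uv}_i would carry flow 2·flow(Z*), whose energy 8g is impossible.
--
-- Conversely a 3-colouring c is realised by sending A^v_{c(v)} onto z and the other copies A^v_i to the
-- vertex 0 of z, and by filling each gadget with the map P_ℓ × B → Z that ValidL provides for its active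
-- copy (or with the constant map when no copy is active).

module Summation where

  open import Data.Nat as ℕ using (ℕ; zero; suc)
  import Data.Nat.Properties as ℕₚ
  open import Data.Integer using (ℤ; 0ℤ; 1ℤ; -1ℤ; +_; _+_; _-_; -_; _*_)
  import Data.Integer.Properties as ℤₚ
  open import Data.Bool using (if_then_else_)
  open import Data.Fin as Fin using (Fin; toℕ; _≟_)
  open import Function using (_∘_)
  open import Relation.Nullary using (does)
  open import Relation.Binary.PropositionalEquality

  open import Algebra.Properties.Semiring.Sum ℤₚ.+-*-semiring public
    using (sum; sum-cong-≗; sum-init-last; ∑-distrib-+; ∑-comm; *-distribˡ-sum)

  sum-zero : ∀ {k} (f : Fin k → ℤ) → (∀ i → f i ≡ 0ℤ) → sum f ≡ 0ℤ
  sum-zero {zero}  f f≡0 = refl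
  sum-zero {suc k} f f≡0 = cong₂ _+_ (f≡0 Fin.zero) (sum-zero (f ∘ Fin.suc) (f≡0 ∘ Fin.suc))

  sum-const : ∀ k (c : ℤ) → sum {k} (λ _ → c) ≡ + k * c
  sum-const zero    c = refl
  sum-const (suc k) c = trans (cong (_+_ c) (sum-const k c)) (sym (ℤₚ.suc-* (+ k) c))

  sum-neg : ∀ {k} (f : Fin k → ℤ) → sum (λ i → - f i) ≡ - sum f
  sum-neg f = trans (sum-cong-≗ (λ i → sym (ℤₚ.-1*i≡-i (f i)))) (trans (sym (*-distribˡ-sum -1ℤ f)) (ℤₚ.-1*i≡-i (sum f)))

  sum-minus : ∀ {k} (f g : Fin k → ℤ) → sum (λ i → f i - g i) ≡ sum f - sum g
  sum-minus f g = trans (∑-distrib-+ f (λ i → - g i)) (cong (_+_ (sum f)) (sum-neg g))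

  indicator : ∀ {k} → Fin k → Fin k → ℤ
  indicator i u = if does (i ≟ u) then 1ℤ else 0ℤ

  sum-indicator : ∀ {k} (u : Fin k) (f : Fin k → ℤ) → sum (λ i → f i * indicator i u) ≡ f u
  sum-indicator {suc k} Fin.zero f =
    trans (cong₂ _+_ (ℤₚ.*-identityʳ (f Fin.zero)) (sum-zero _ (λ i → ℤₚ.*-zeroʳ (f (Fin.suc i))))) (ℤₚ.+-identityʳ _)
  sum-indicator {suc k} (Fin.suc u) f =
    trans (cong₂ _+_ (ℤₚ.*-zeroʳ (f Fin.zero)) (sum-indicator u (f ∘ Fin.suc))) (ℤₚ.+-identityˡ _)

  rangeSum : (ℕ → ℤ) → ℕ → ℕ → ℤ
  rangeSum F n zero    = 0ℤ
  rangeSum F n (suc l) = F n + rangeSum F (suc n) l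

  rangeSum-cong : ∀ {F G : ℕ → ℤ} n l → (∀ i → i ℕ.< l → F (n ℕ.+ i) ≡ G (n ℕ.+ i)) →
    rangeSum F n l ≡ rangeSum G n l
  rangeSum-cong n zero    F≡G = refl
  rangeSum-cong {F} {G} n (suc l) F≡G = cong₂ _+_
    (subst (λ t → F t ≡ G t) (ℕₚ.+-identityʳ n) (F≡G 0 (ℕ.s≤s ℕ.z≤n)))
    (rangeSum-cong (suc n) l λ i i<l → subst (λ t → F t ≡ G t) (ℕₚ.+-suc n i) (F≡G (suc i) (ℕ.s≤s i<l)))

  rangeSum-cong-≗ : ∀ {F G : ℕ → ℤ} n l → (∀ t → F t ≡ G t) → rangeSum F n l ≡ rangeSum G n l
  rangeSum-cong-≗ n l F≗G = rangeSum-cong n l (λ i _ → F≗G _)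

  rangeSum-neg : ∀ (F : ℕ → ℤ) n l → rangeSum (λ t → - F t) n l ≡ - rangeSum F n l
  rangeSum-neg F n zero    = refl
  rangeSum-neg F n (suc l) = trans (cong (_+_ (- F n)) (rangeSum-neg F (suc n) l)) (sym (ℤₚ.neg-distrib-+ (F n) _))

  rangeSum-split : ∀ (F : ℕ → ℤ) n l₁ l₂ → rangeSum F n (l₁ ℕ.+ l₂) ≡ rangeSum F n l₁ + rangeSum F (n ℕ.+ l₁) l₂
  rangeSum-split F n zero      l₂ rewrite ℕₚ.+-identityʳ n = sym (ℤₚ.+-identityˡ _)
  rangeSum-split F n (suc l₁) l₂ rewrite rangeSum-split F (suc n) l₁ l₂ | ℕₚ.+-suc n l₁ = sym (ℤₚ.+-assoc (F n) _ _)

  rangeSum-shift : ∀ (F : ℕ → ℤ) n l → rangeSum (λ t → F (n ℕ.+ t)) 0 l ≡ rangeSum F n l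
  rangeSum-shift F n l = trans (go 0 l) (cong (λ k → rangeSum F k l) (ℕₚ.+-identityʳ n))
    where
    go : ∀ k l → rangeSum (λ t → F (n ℕ.+ t)) k l ≡ rangeSum F (n ℕ.+ k) l
    go k zero    = refl
    go k (suc l) rewrite go (suc k) l | ℕₚ.+-suc n k = refl

  rangeSum-reverse : ∀ (F : ℕ → ℤ) l → rangeSum (λ t → F (l ℕ.∸ suc t)) 0 l ≡ rangeSum F 0 l
  rangeSum-reverse F zero    = refl
  rangeSum-reverse F (suc l) = begin
    F l + rangeSum (λ t → F (suc l ℕ.∸ suc t)) 1 l ≡⟨ cong (_+_ (F l)) (sym (rangeSum-shift _ 1 l)) ⟩
    F l + rangeSum (λ t → F (l ℕ.∸ suc t)) 0 l     ≡⟨ cong (_+_ (F l)) (rangeSum-reverse F l) ⟩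
    F l + rangeSum F 0 l                           ≡⟨ ℤₚ.+-comm (F l) _ ⟩
    rangeSum F 0 l + F l                           ≡⟨ cong (_+_ (rangeSum F 0 l)) (sym (ℤₚ.+-identityʳ (F l))) ⟩
    rangeSum F 0 l + rangeSum F l 1                ≡⟨ sym (rangeSum-split F 0 l 1) ⟩
    rangeSum F 0 (l ℕ.+ 1)                         ≡⟨ cong (rangeSum F 0) (ℕₚ.+-comm l 1) ⟩
    rangeSum F 0 (suc l)                           ∎
    where open ≡-Reasoning

  rangeSum-blocks : ∀ (F : ℕ → ℤ) n k l → rangeSum F n (k ℕ.* l) ≡ rangeSum (λ i → rangeSum F (n ℕ.+ i ℕ.* l) l) 0 k
  rangeSum-blocks F n zero    l = refl
  rangeSum-blocks F n (suc k) l = begin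
    rangeSum F n (l ℕ.+ k ℕ.* l)                                        ≡⟨ rangeSum-split F n l (k ℕ.* l) ⟩
    rangeSum F n l + rangeSum F (n ℕ.+ l) (k ℕ.* l)                     ≡⟨ cong₂ _+_ (cong (λ t → rangeSum F t l) (sym (ℕₚ.+-identityʳ n)))
                                                                                  (rangeSum-blocks F (n ℕ.+ l) k l) ⟩
    rangeSum F (n ℕ.+ 0) l + rangeSum (λ i → rangeSum F (n ℕ.+ l ℕ.+ i ℕ.* l) l) 0 k
      ≡⟨ cong (_+_ (rangeSum F (n ℕ.+ 0) l)) (trans (rangeSum-cong-≗ 0 k (λ i → cong (λ t → rangeSum F t l) (ℕₚ.+-assoc n l (i ℕ.* l))))
                                                   (rangeSum-shift (λ i → rangeSum F (n ℕ.+ i ℕ.* l) l) 1 k)) ⟩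
    rangeSum F (n ℕ.+ 0) l + rangeSum (λ i → rangeSum F (n ℕ.+ i ℕ.* l) l) 1 k ∎
    where open ≡-Reasoning

  rangeSum-rotate : ∀ (F : ℕ → ℤ) p I → (∀ t → F (t ℕ.+ p) ≡ F t) → I ℕ.≤ p → rangeSum F 0 p ≡ rangeSum F I p
  rangeSum-rotate F p I periodic I≤p = begin
    rangeSum F 0 p                             ≡⟨ cong (rangeSum F 0) (sym (ℕₚ.m+[n∸m]≡n I≤p)) ⟩
    rangeSum F 0 (I ℕ.+ (p ℕ.∸ I))             ≡⟨ rangeSum-split F 0 I (p ℕ.∸ I) ⟩
    rangeSum F 0 I + rangeSum F I (p ℕ.∸ I)    ≡⟨ ℤₚ.+-comm (rangeSum F 0 I) _ ⟩
    rangeSum F I (p ℕ.∸ I) + rangeSum F 0 I    ≡⟨ cong (_+_ (rangeSum F I (p ℕ.∸ I))) head≡tail ⟩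
    rangeSum F I (p ℕ.∸ I) + rangeSum F (I ℕ.+ (p ℕ.∸ I)) I
                                               ≡⟨ sym (rangeSum-split F I (p ℕ.∸ I) I) ⟩
    rangeSum F I ((p ℕ.∸ I) ℕ.+ I)             ≡⟨ cong (rangeSum F I) (ℕₚ.m∸n+n≡m I≤p) ⟩
    rangeSum F I p                             ∎
    where
    open ≡-Reasoning
    head≡tail : rangeSum F 0 I ≡ rangeSum F (I ℕ.+ (p ℕ.∸ I)) I
    head≡tail = begin
      rangeSum F 0 I                       ≡⟨ rangeSum-cong-≗ 0 I (λ t → trans (sym (periodic t)) (cong F (ℕₚ.+-comm t p))) ⟩
      rangeSum (λ t → F (p ℕ.+ t)) 0 I     ≡⟨ rangeSum-shift F p I ⟩
      rangeSum F p I                       ≡⟨ cong (λ n → rangeSum F n I) (sym (ℕₚ.m+[n∸m]≡n I≤p)) ⟩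
      rangeSum F (I ℕ.+ (p ℕ.∸ I)) I       ∎

  sum≡rangeSum : ∀ {k} (f : Fin k → ℤ) (F : ℕ → ℤ) n → (∀ i → f i ≡ F (n ℕ.+ toℕ i)) → sum f ≡ rangeSum F n k
  sum≡rangeSum {zero}  f F n f≡F = refl
  sum≡rangeSum {suc k} f F n f≡F = cong₂ _+_ (trans (f≡F Fin.zero) (cong F (ℕₚ.+-identityʳ n)))
    (sum≡rangeSum (f ∘ Fin.suc) F (suc n) (λ i → trans (f≡F (Fin.suc i)) (cong F (ℕₚ.+-suc n (toℕ i)))))

module CyclicIndex where

  open import Data.Nat using (ℕ; zero; suc; _+_; _∸_; _<_; _≤_; z≤n; s≤s; NonZero; _<?_)
  open import Data.Nat.Properties
  open import Data.Nat.DivMod using (_%_; _mod_; n%n≡0; [m+n]%n≡m%n; %-distribˡ-+; m%n%n≡m%n; m<n⇒m%n≡m)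
  open import Data.Integer as ℤ using (ℤ)
  import Data.Integer.Properties as ℤₚ
  open import Data.Fin as Fin using (Fin; toℕ; inject₁; opposite)
  open import Function using (_∘_)
  import Data.Fin.Properties as Finₚ
  open import Data.Product using (Σ; _×_; _,_)
  open import Data.Sum using (_⊎_; inj₁; inj₂)
  open import Data.Empty using (⊥-elim)
  open import Relation.Nullary using (yes; no)
  open import Relation.Nullary.Decidable using (_→-dec_)
  open import Relation.Binary using (tri<; tri≈; tri>)
  open import Relation.Binary.PropositionalEquality
  open import Defs hiding (sym)
  open Summation

  toℕ-next-< : ∀ {k} (a : Fin k) → suc (toℕ a) < k → toℕ (next a) ≡ suc (toℕ a)
  toℕ-next-< {suc k} a lt with suc (toℕ a) <? suc k
  ... | yes p = Finₚ.toℕ-fromℕ< p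
  ... | no ¬p = ⊥-elim (¬p lt)

  toℕ-next-last : ∀ {k} (a : Fin k) → suc (toℕ a) ≡ k → toℕ (next a) ≡ 0
  toℕ-next-last {suc k} a eq with suc (toℕ a) <? suc k
  ... | yes p = ⊥-elim (<-irrefl eq p)
  ... | no _  = refl

  suc-toℕ-<-or-≡ : ∀ {k} (a : Fin k) → suc (toℕ a) < k ⊎ suc (toℕ a) ≡ k
  suc-toℕ-<-or-≡ a = m≤n⇒m<n∨m≡n (Finₚ.toℕ<n a)

  toℕ-next : ∀ {k} .{{_ : NonZero k}} (a : Fin k) → toℕ (next a) ≡ suc (toℕ a) % k
  toℕ-next {k} a with suc-toℕ-<-or-≡ a
  ... | inj₁ lt = trans (toℕ-next-< a lt) (sym (m<n⇒m%n≡m lt))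
  ... | inj₂ eq = trans (toℕ-next-last a eq) (sym (trans (cong (_% k) eq) (n%n≡0 k)))

  next-inject₁ : ∀ {k} (a : Fin k) → next (inject₁ a) ≡ Fin.suc a
  next-inject₁ {k} a = Finₚ.toℕ-injective (trans (toℕ-next-< (inject₁ a) (s≤s lt)) (cong suc (Finₚ.toℕ-inject₁ a)))
    where
    lt : toℕ (inject₁ a) < k
    lt = subst (_< k) (sym (Finₚ.toℕ-inject₁ a)) (Finₚ.toℕ<n a)

  next-last : ∀ k → next (Fin.fromℕ k) ≡ Fin.zero
  next-last k = Finₚ.toℕ-injective (toℕ-next-last (Fin.fromℕ k) (cong suc (Finₚ.toℕ-fromℕ k)))

  next≢id : ∀ {k} → 2 ≤ k → (a : Fin k) → next a ≢ a
  next≢id k≥2 a eq with suc-toℕ-<-or-≡ a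
  ... | inj₁ lt  = 1+n≢n (trans (sym (toℕ-next-< a lt)) (cong toℕ eq))
  ... | inj₂ eq′ = <⇒≱ k≥2 (≤-reflexive (trans (sym eq′) (cong suc (trans (sym (cong toℕ eq)) (toℕ-next-last a eq′)))))

  next²≢id : ∀ {k} → 3 ≤ k → (a : Fin k) → next (next a) ≢ a
  next²≢id {k} k≥3 a eq with suc-toℕ-<-or-≡ a
  ... | inj₂ a-last = <⇒≢ k≥3 (sym (trans (sym a-last) (cong suc a≡1)))
    where
    next-a≡0 : toℕ (next a) ≡ 0
    next-a≡0 = toℕ-next-last a a-last
    a≡1 : toℕ a ≡ 1
    a≡1 = trans (sym (cong toℕ eq))
      (trans (toℕ-next-< (next a) (subst (λ t → suc t < k) (sym next-a≡0) (≤-trans (s≤s (s≤s z≤n)) k≥3)))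
             (cong suc next-a≡0))
  ... | inj₁ lt with suc-toℕ-<-or-≡ (next a)
  ...   | inj₁ lt′ = m+1+n≢n 1 (trans (sym (trans (toℕ-next-< (next a) lt′) (cong suc (toℕ-next-< a lt)))) (cong toℕ eq))
  ...   | inj₂ next-a-last = <⇒≢ k≥3 (sym (trans (sym next-a-last) (cong suc (trans (toℕ-next-< a lt) (cong suc a≡0)))))
    where
    a≡0 : toℕ a ≡ 0
    a≡0 = trans (sym (cong toℕ eq)) (toℕ-next-last (next a) next-a-last)

  sum-next : ∀ {k} (f : Fin k → ℤ) → sum (f ∘ next) ≡ sum f
  sum-next {zero}  f = refl
  sum-next {suc k} f = begin
    sum (f ∘ next)                                     ≡⟨ sum-init-last (f ∘ next) ⟩
    sum (λ i → f (next (Fin.inject₁ i))) ℤ.+ f (next (Fin.fromℕ k))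
                                                       ≡⟨ cong₂ ℤ._+_ (sum-cong-≗ (λ i → cong f (next-inject₁ i))) (cong f (next-last k)) ⟩
    sum (f ∘ Fin.suc) ℤ.+ f Fin.zero                   ≡⟨ ℤₚ.+-comm _ (f Fin.zero) ⟩
    sum f                                              ∎
    where open ≡-Reasoning

  cyclic : ∀ {k} .{{_ : NonZero k}} {X : Set} → (Fin k → X) → ℕ → X
  cyclic {k} w t = w (t mod k)

  module _ {k : ℕ} .{{_ : NonZero k}} {X : Set} (w : Fin k → X) where

    cyclic-≡ : ∀ t (a : Fin k) → t % k ≡ toℕ a → cyclic w t ≡ w a
    cyclic-≡ t a eq = cong w (Finₚ.toℕ-injective (trans (Finₚ.toℕ-fromℕ< _) eq))

    cyclic-toℕ : ∀ (a : Fin k) → cyclic w (toℕ a) ≡ w a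
    cyclic-toℕ a = cyclic-≡ (toℕ a) a (m<n⇒m%n≡m (Finₚ.toℕ<n a))

    cyclic-at : ∀ (a : Fin k) {t} → toℕ a ≡ t → cyclic w t ≡ w a
    cyclic-at a refl = cyclic-toℕ a

    cyclic-suc-toℕ : ∀ (a : Fin k) → cyclic w (suc (toℕ a)) ≡ w (next a)
    cyclic-suc-toℕ a = cyclic-≡ (suc (toℕ a)) (next a) (sym (toℕ-next a))

    cyclic-+ : ∀ t → cyclic w (t + k) ≡ cyclic w t
    cyclic-+ t = cyclic-≡ (t + k) (t mod k) (trans ([m+n]%n≡m%n t k) (sym (Finₚ.toℕ-fromℕ< _)))

    cyclic-suc : ∀ t → cyclic w (suc t) ≡ w (next (t mod k))
    cyclic-suc t = cyclic-≡ (suc t) (next (t mod k)) (begin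
      suc t % k                     ≡⟨ %-distribˡ-+ 1 t k ⟩
      (1 % k + t % k) % k           ≡⟨ cong (λ m → (1 % k + m) % k) (sym (m%n%n≡m%n t k)) ⟩
      (1 % k + t % k % k) % k       ≡⟨ sym (%-distribˡ-+ 1 (t % k) k) ⟩
      suc (t % k) % k               ≡⟨ cong (λ m → suc m % k) (sym (Finₚ.toℕ-fromℕ< _)) ⟩
      suc (toℕ (t mod k)) % k       ≡⟨ sym (toℕ-next (t mod k)) ⟩
      toℕ (next (t mod k))          ∎)
      where open ≡-Reasoning

    cyclic-steps : ∀ (R : X → X → Set) → (∀ a → R (w a) (w (next a))) → ∀ t → R (cyclic w t) (cyclic w (suc t))
    cyclic-steps R along t = subst (R (cyclic w t)) (sym (cyclic-suc t)) (along (t mod k))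

  CycAdj-refl : ∀ {k} (a : Fin k) → CycAdj a a
  CycAdj-refl a = inj₁ refl

  CycAdj-sym : ∀ {k} {a b : Fin k} → CycAdj a b → CycAdj b a
  CycAdj-sym (inj₁ eq)                         = inj₁ (sym eq)
  CycAdj-sym (inj₂ (inj₁ eq))                  = inj₂ (inj₂ (inj₁ eq))
  CycAdj-sym (inj₂ (inj₂ (inj₁ eq)))           = inj₂ (inj₁ eq)
  CycAdj-sym (inj₂ (inj₂ (inj₂ (inj₁ wrap))))  = inj₂ (inj₂ (inj₂ (inj₂ wrap)))
  CycAdj-sym (inj₂ (inj₂ (inj₂ (inj₂ wrap))))  = inj₂ (inj₂ (inj₂ (inj₁ wrap)))

  CycAdj-next : ∀ {k} (a : Fin k) → CycAdj a (next a)
  CycAdj-next a with suc-toℕ-<-or-≡ a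
  ... | inj₁ lt = inj₂ (inj₁ (sym (toℕ-next-< a lt)))
  ... | inj₂ eq = inj₂ (inj₂ (inj₂ (inj₁ (eq , toℕ-next-last a eq))))

  CycAdj⇒next : ∀ {k} {a b : Fin k} → CycAdj a b → b ≡ next a ⊎ a ≡ next b ⊎ a ≡ b
  CycAdj⇒next {k} {a} {b} (inj₁ eq) = inj₂ (inj₂ (Finₚ.toℕ-injective eq))
  CycAdj⇒next {k} {a} {b} (inj₂ (inj₁ eq)) =
    inj₁ (Finₚ.toℕ-injective (sym (trans (toℕ-next-< a (subst (_< k) (sym eq) (Finₚ.toℕ<n b))) eq)))
  CycAdj⇒next {k} {a} {b} (inj₂ (inj₂ (inj₁ eq))) =
    inj₂ (inj₁ (Finₚ.toℕ-injective (sym (trans (toℕ-next-< b (subst (_< k) (sym eq) (Finₚ.toℕ<n a))) eq))))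
  CycAdj⇒next {k} {a} {b} (inj₂ (inj₂ (inj₂ (inj₁ (a-last , b≡0))))) =
    inj₁ (Finₚ.toℕ-injective (trans b≡0 (sym (toℕ-next-last a a-last))))
  CycAdj⇒next {k} {a} {b} (inj₂ (inj₂ (inj₂ (inj₂ (b-last , a≡0))))) =
    inj₂ (inj₁ (Finₚ.toℕ-injective (trans a≡0 (sym (toℕ-next-last b b-last)))))

  next⇒CycAdj : ∀ {k} {a b : Fin k} → b ≡ next a ⊎ a ≡ next b ⊎ a ≡ b → CycAdj a b
  next⇒CycAdj {a = a} (inj₁ refl)        = CycAdj-next a
  next⇒CycAdj {b = b} (inj₂ (inj₁ refl)) = CycAdj-sym (CycAdj-next b)
  next⇒CycAdj         (inj₂ (inj₂ refl)) = CycAdj-refl _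

  PathAdj-refl : ∀ {k} (p : Fin k) → PathAdj p p
  PathAdj-refl p = inj₁ refl

  PathAdj-inject₁-suc : ∀ {k} (p : Fin k) → PathAdj (inject₁ p) (Fin.suc p)
  PathAdj-inject₁-suc p = inj₂ (inj₁ (cong suc (Finₚ.toℕ-inject₁ p)))

  module _ {k : ℕ} .{{_ : NonZero k}} where

    toℕ-neg : (a : Fin k) → toℕ (neg a) ≡ (k ∸ toℕ a) % k
    toℕ-neg a = trans (toℕ-next (opposite a))
      (cong (_% k) (trans (cong suc (Finₚ.opposite-prop a)) (sym (+-∸-assoc 1 (Finₚ.toℕ<n a)))))

    toℕ-neg-0 : (a : Fin k) → toℕ a ≡ 0 → toℕ (neg a) ≡ 0
    toℕ-neg-0 a a≡0 = trans (toℕ-neg a) (trans (cong (λ m → (k ∸ m) % k) a≡0) (n%n≡0 k))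

    next-neg-next : (a : Fin k) → next (neg (next a)) ≡ neg a
    next-neg-next a = Finₚ.toℕ-injective (begin
      toℕ (next (neg (next a)))           ≡⟨ toℕ-next (neg (next a)) ⟩
      suc (toℕ (neg (next a))) % k        ≡⟨ cong (λ m → suc m % k) (toℕ-neg (next a)) ⟩
      suc ((k ∸ toℕ (next a)) % k) % k    ≡⟨ sym (by-position (suc-toℕ-<-or-≡ a)) ⟩
      (k ∸ toℕ a) % k                     ≡⟨ sym (toℕ-neg a) ⟩
      toℕ (neg a)                         ∎)
      where
      open ≡-Reasoning
      by-position : suc (toℕ a) < k ⊎ suc (toℕ a) ≡ k → (k ∸ toℕ a) % k ≡ suc ((k ∸ toℕ (next a)) % k) % k
      by-position (inj₁ lt) rewrite toℕ-next-< a lt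
                                  | m<n⇒m%n≡m (∸-monoʳ-< {k} {suc (toℕ a)} {0} (s≤s z≤n) (<⇒≤ lt)) =
        cong (_% k) (+-∸-assoc 1 (Finₚ.toℕ<n a))
      by-position (inj₂ eq) rewrite toℕ-next-last a eq =
        trans (cong (_% k) (trans (cong (_∸ toℕ a) (sym eq)) (m+n∸n≡m 1 (toℕ a))))
              (cong (λ m → suc m % k) (sym (n%n≡0 k)))

    neg-CycAdj : {a b : Fin k} → CycAdj a b → CycAdj (neg a) (neg b)
    neg-CycAdj {a} {b} adj with CycAdj⇒next adj
    ... | inj₁ refl        = next⇒CycAdj (inj₂ (inj₁ (sym (next-neg-next a))))
    ... | inj₂ (inj₁ refl) = next⇒CycAdj (inj₁ (sym (next-neg-next b)))
    ... | inj₂ (inj₂ refl) = CycAdj-refl _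

  injective⊎collision : ∀ {k n} (w : Fin k → Fin n) →
    (∀ i j → w i ≡ w j → i ≡ j) ⊎ Σ (Fin k) λ i → Σ (Fin k) λ j → toℕ i < toℕ j × w i ≡ w j
  injective⊎collision {k} w with Finₚ.all? (λ i → Finₚ.all? (λ j → (w i Fin.≟ w j) →-dec (i Fin.≟ j)))
  ... | yes injective = inj₁ injective
  ... | no ¬injective with Finₚ.¬∀⟶∃¬ k _ (λ i → Finₚ.all? (λ j → (w i Fin.≟ w j) →-dec (i Fin.≟ j))) ¬injective
  ...   | i , ¬all with Finₚ.¬∀⟶∃¬ k _ (λ j → (w i Fin.≟ w j) →-dec (i Fin.≟ j)) ¬all
  ...     | j , ¬implies with w i Fin.≟ w j
  ...       | no  wi≢wj = ⊥-elim (¬implies (λ wi≡wj → ⊥-elim (wi≢wj wi≡wj)))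
  ...       | yes wi≡wj with <-cmp (toℕ i) (toℕ j)
  ...         | tri< i<j _ _ = inj₂ (i , j , i<j , wi≡wj)
  ...         | tri≈ _ i≡j _ = ⊥-elim (¬implies (λ _ → Finₚ.toℕ-injective i≡j))
  ...         | tri> _ _ j<i = inj₂ (j , i , j<i , sym wi≡wj)

module Energy where

  open import Data.Nat as ℕ using (ℕ; zero; suc; z≤n; s≤s)
  import Data.Nat.Properties as ℕₚ
  open import Data.Integer as ℤ using (ℤ; 0ℤ; 1ℤ; +_; -[1+_]; ∣_∣; _+_; _-_; -_; _*_; _≤_; +≤+)
  import Data.Integer.Properties as ℤₚ
  open import Data.Integer.Tactic.RingSolver using (solve-∀)
  open import Data.Fin as Fin using (Fin)
  open import Data.Fin.Patterns using (0F; 1F; 2F)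
  open import Data.Product using (Σ; _,_)
  open import Data.Empty using (⊥-elim)
  open import Relation.Nullary using (¬_)
  open import Data.Sum using (_⊎_; inj₁; inj₂; [_,_]′)
  open import Function using (_∘_; id)
  open import Relation.Binary.PropositionalEquality using (_≡_; _≢_; refl; sym; trans; cong; cong₂; subst; module ≡-Reasoning)
  open Summation

  square≡∣∣² : ∀ x → x * x ≡ + (∣ x ∣ ℕ.* ∣ x ∣)
  square≡∣∣² (+ n)    = sym (ℤₚ.pos-* n n)
  square≡∣∣² -[1+ n ] = refl

  square-nonneg : ∀ x → 0ℤ ≤ x * x
  square-nonneg x = subst (0ℤ ≤_) (sym (square≡∣∣² x)) (+≤+ z≤n)

  square≡0⇒≡0 : ∀ x → x * x ≡ 0ℤ → x ≡ 0ℤ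
  square≡0⇒≡0 x x²≡0 =
    ℤₚ.∣i∣≡0⇒i≡0 ([ id , id ]′ (ℕₚ.m*n≡0⇒m≡0∨n≡0 ∣ x ∣ (ℤₚ.+-injective (trans (sym (square≡∣∣² x)) x²≡0))))

  sum-nonneg : ∀ {k} (f : Fin k → ℤ) → (∀ i → 0ℤ ≤ f i) → 0ℤ ≤ sum f
  sum-nonneg {zero}  f f≥0 = +≤+ z≤n
  sum-nonneg {suc k} f f≥0 = ℤₚ.+-mono-≤ (f≥0 Fin.zero) (sum-nonneg (f ∘ Fin.suc) (f≥0 ∘ Fin.suc))

  nonneg-sum≡0 : ∀ {k} (f : Fin k → ℤ) → (∀ i → 0ℤ ≤ f i) → sum f ≡ 0ℤ → ∀ i → f i ≡ 0ℤ
  nonneg-sum≡0 {suc k} f f≥0 sum≡0 = at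
    where
    rest : ℤ
    rest = sum (f ∘ Fin.suc)
    head≡0 : f Fin.zero ≡ 0ℤ
    head≡0 = ℤₚ.≤-antisym
      (subst (f Fin.zero ≤_) sum≡0
        (subst (_≤ f Fin.zero + rest) (ℤₚ.+-identityʳ (f Fin.zero))
          (ℤₚ.+-monoʳ-≤ (f Fin.zero) (sum-nonneg (f ∘ Fin.suc) (f≥0 ∘ Fin.suc)))))
      (f≥0 Fin.zero)
    rest≡0 : rest ≡ 0ℤ
    rest≡0 = trans (sym (ℤₚ.+-identityˡ rest)) (trans (cong (_+ rest) (sym head≡0)) sum≡0)
    at : ∀ i → f i ≡ 0ℤ
    at Fin.zero    = head≡0
    at (Fin.suc i) = nonneg-sum≡0 (f ∘ Fin.suc) (f≥0 ∘ Fin.suc) rest≡0 i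

  energy : ∀ {n} → (Fin n → Fin n → ℤ) → ℤ
  energy F = sum (λ a → sum (λ b → F a b * F a b))

  module _ {n : ℕ} where

    energy-cong : {F G : Fin n → Fin n → ℤ} → (∀ a b → F a b ≡ G a b) → energy F ≡ energy G
    energy-cong F≡G = sum-cong-≗ (λ a → sum-cong-≗ (λ b → cong₂ _*_ (F≡G a b) (F≡G a b)))

    energy≡0⇒≡0 : (F : Fin n → Fin n → ℤ) → energy F ≡ 0ℤ → ∀ a b → F a b ≡ 0ℤ
    energy≡0⇒≡0 F energy≡0 a b =
      square≡0⇒≡0 (F a b) (nonneg-sum≡0 _ (λ b → square-nonneg (F a b)) (nonneg-sum≡0 _ row≥0 energy≡0 a) b)
      where
      row≥0 : ∀ a → 0ℤ ≤ sum (λ b → F a b * F a b)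
      row≥0 a = sum-nonneg _ (λ b → square-nonneg (F a b))

    private
      sum² : (Fin n → Fin n → ℤ) → ℤ
      sum² G = sum (λ a → sum (λ b → G a b))

      sum²-+ : ∀ (G G′ : Fin n → Fin n → ℤ) → sum² (λ a b → G a b + G′ a b) ≡ sum² G + sum² G′
      sum²-+ G G′ = trans (sum-cong-≗ (λ a → ∑-distrib-+ (G a) (G′ a))) (∑-distrib-+ (λ a → sum (G a)) (λ a → sum (G′ a)))

      sum²-* : ∀ c (G : Fin n → Fin n → ℤ) → sum² (λ a b → c * G a b) ≡ c * sum² G
      sum²-* c G = sym (trans (*-distribˡ-sum c (λ a → sum (G a))) (sum-cong-≗ (λ a → *-distribˡ-sum c (G a))))

    energy-double : (F : Fin n → Fin n → ℤ) → energy (λ a b → F a b + F a b) ≡ + 4 * energy F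
    energy-double F = trans (sum-cong-≗ (λ a → sum-cong-≗ (λ b → quadruple (F a b)))) (sum²-* (+ 4) (λ a b → F a b * F a b))
      where quadruple : ∀ x → (x + x) * (x + x) ≡ + 4 * (x * x)
            quadruple = solve-∀

    energy-four-squares : (P Q R : Fin n → Fin n → ℤ) →
      energy (λ a b → P a b + Q a b + R a b) + energy (λ a b → P a b - Q a b)
        + energy (λ a b → P a b - R a b) + energy (λ a b → Q a b - R a b)
      ≡ + 3 * (energy P + energy Q + energy R)
    energy-four-squares P Q R = begin
      sq (λ a b → P a b + Q a b + R a b) + sq (λ a b → P a b - Q a b) + sq (λ a b → P a b - R a b) + sq (λ a b → Q a b - R a b)
        ≡⟨ cong (_+ sq (λ a b → Q a b - R a b)) (trans (cong (_+ sq (λ a b → P a b - R a b)) (sym (sum²-+ _ _))) (sym (sum²-+ _ _))) ⟩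
      sum² (λ a b → ² (P a b + Q a b + R a b) + ² (P a b - Q a b) + ² (P a b - R a b)) + sq (λ a b → Q a b - R a b)
        ≡⟨ sym (sum²-+ _ _) ⟩
      sum² (λ a b → ² (P a b + Q a b + R a b) + ² (P a b - Q a b) + ² (P a b - R a b) + ² (Q a b - R a b))
        ≡⟨ sum-cong-≗ (λ a → sum-cong-≗ (λ b → pointwise (P a b) (Q a b) (R a b))) ⟩
      sum² (λ a b → + 3 * (² (P a b) + ² (Q a b) + ² (R a b)))
        ≡⟨ sum²-* (+ 3) _ ⟩
      + 3 * sum² (λ a b → ² (P a b) + ² (Q a b) + ² (R a b))
        ≡⟨ cong (+ 3 *_) (trans (sum²-+ _ _) (cong (_+ sq R) (sum²-+ _ _))) ⟩
      + 3 * (sq P + sq Q + sq R) ∎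
      where
      open ≡-Reasoning
      sq : (Fin n → Fin n → ℤ) → ℤ
      sq = energy
      ² : ℤ → ℤ
      ² x = x * x
      pointwise : ∀ p q r → (p + q + r) * (p + q + r) + (p - q) * (p - q) + (p - r) * (p - r) + (q - r) * (q - r)
                            ≡ + 3 * (p * p + q * q + r * r)
      pointwise = solve-∀

  suc≡3*⇒≡1 : ∀ {A B} → B ℕ.≤ 3 → suc B ≡ 3 ℕ.* A → A ≡ 1
  suc≡3*⇒≡1 {zero}        _   ()
  suc≡3*⇒≡1 {suc zero}    _   _  = refl
  suc≡3*⇒≡1 {suc (suc A)} B≤3 eq =
    ⊥-elim (6≰4 (ℕₚ.≤-trans (ℕₚ.*-monoʳ-≤ 3 (s≤s (s≤s z≤n))) (subst (ℕ._≤ 4) eq (s≤s B≤3))))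
    where
    6≰4 : ¬ 6 ℕ.≤ 4
    6≰4 (s≤s (s≤s (s≤s (s≤s ()))))

  module _ {n : ℕ} (E : ℤ) .{{_ : ℤ.NonZero E}} where

    Binary : (Fin n → Fin n → ℤ) → Set
    Binary F = energy F ≡ 0ℤ ⊎ energy F ≡ E

    Binary-cong : ∀ {F F′ : Fin n → Fin n → ℤ} → (∀ a b → F a b ≡ F′ a b) → Binary F → Binary F′
    Binary-cong F≡F′ = subst (λ e → e ≡ 0ℤ ⊎ e ≡ E) (energy-cong F≡F′)

    private
      level : ∀ {e : ℤ} → e ≡ 0ℤ ⊎ e ≡ E → ℕ
      level (inj₁ _) = 0
      level (inj₂ _) = 1

      level≤1 : ∀ {e} (b : e ≡ 0ℤ ⊎ e ≡ E) → level b ℕ.≤ 1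
      level≤1 (inj₁ _) = z≤n
      level≤1 (inj₂ _) = s≤s z≤n

      energy≡level : ∀ {e} (b : e ≡ 0ℤ ⊎ e ≡ E) → e ≡ E * + level b
      energy≡level (inj₁ e≡0) = trans e≡0 (sym (ℤₚ.*-zeroʳ E))
      energy≡level (inj₂ e≡E) = trans e≡E (sym (ℤₚ.*-identityʳ E))

    all-but-one-vanish : (F : Fin 3 → Fin n → Fin n → ℤ) →
      energy (λ a b → F 0F a b + F 1F a b + F 2F a b) ≡ E →
      (∀ i → Binary (F i)) → (∀ i j → i Fin.< j → Binary (λ a b → F i a b - F j a b)) →
      Σ (Fin 3) λ i → ∀ j → j ≢ i → ∀ a b → F j a b ≡ 0ℤ
    all-but-one-vanish F sum≡E single pair =
      pick (single 0F) (single 1F) (single 2F) (suc≡3*⇒≡1 bound (ℤₚ.+-injective (ℤₚ.*-cancelˡ-≡ E _ _ count)))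
      where
      open ≡-Reasoning
      b₁ : Binary (λ a b → F 0F a b - F 1F a b)
      b₁ = pair 0F 1F (s≤s z≤n)
      b₂ : Binary (λ a b → F 0F a b - F 2F a b)
      b₂ = pair 0F 2F (s≤s z≤n)
      b₃ : Binary (λ a b → F 1F a b - F 2F a b)
      b₃ = pair 1F 2F (s≤s (s≤s z≤n))
      α₀ α₁ α₂ β : ℕ
      α₀ = level (single 0F)
      α₁ = level (single 1F)
      α₂ = level (single 2F)
      β  = level b₁ ℕ.+ level b₂ ℕ.+ level b₃

      bound : β ℕ.≤ 3
      bound = ℕₚ.+-mono-≤ (ℕₚ.+-mono-≤ (level≤1 b₁) (level≤1 b₂)) (level≤1 b₃)

      -- E (1 + β) = 3 E (α₀ + α₁ + α₂) with β ≤ 3 forces exactly one αᵢ to be 1.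
      count : E * + suc β ≡ E * + (3 ℕ.* (α₀ ℕ.+ α₁ ℕ.+ α₂))
      count = begin
        E * (1ℤ + + level b₁ + + level b₂ + + level b₃)
          ≡⟨ expand E (+ level b₁) (+ level b₂) (+ level b₃) ⟩
        E + E * + level b₁ + E * + level b₂ + E * + level b₃
          ≡⟨ sym (cong₂ _+_ (cong₂ _+_ (cong₂ _+_ sum≡E (energy≡level b₁)) (energy≡level b₂)) (energy≡level b₃)) ⟩
        energy (λ a b → F 0F a b + F 1F a b + F 2F a b) + energy (λ a b → F 0F a b - F 1F a b)
          + energy (λ a b → F 0F a b - F 2F a b) + energy (λ a b → F 1F a b - F 2F a b)
          ≡⟨ energy-four-squares (F 0F) (F 1F) (F 2F) ⟩
        + 3 * (energy (F 0F) + energy (F 1F) + energy (F 2F))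
          ≡⟨ cong (+ 3 *_) (cong₂ _+_ (cong₂ _+_ (energy≡level (single 0F)) (energy≡level (single 1F))) (energy≡level (single 2F))) ⟩
        + 3 * (E * + α₀ + E * + α₁ + E * + α₂)
          ≡⟨ factor E (+ α₀) (+ α₁) (+ α₂) ⟩
        E * (+ 3 * (+ α₀ + + α₁ + + α₂))
          ≡⟨ cong (E *_) (sym (ℤₚ.pos-* 3 (α₀ ℕ.+ α₁ ℕ.+ α₂))) ⟩
        E * + (3 ℕ.* (α₀ ℕ.+ α₁ ℕ.+ α₂)) ∎
        where
        expand : ∀ e x y z → e * (1ℤ + x + y + z) ≡ e + e * x + e * y + e * z
        expand = solve-∀
        factor : ∀ e x y z → + 3 * (e * x + e * y + e * z) ≡ e * (+ 3 * (x + y + z))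
        factor = solve-∀

      vanish : ∀ {j} → energy (F j) ≡ 0ℤ → ∀ a b → F j a b ≡ 0ℤ
      vanish {j} = energy≡0⇒≡0 (F j)

      pick : (d₀ : Binary (F 0F)) (d₁ : Binary (F 1F)) (d₂ : Binary (F 2F)) → level d₀ ℕ.+ level d₁ ℕ.+ level d₂ ≡ 1 →
        Σ (Fin 3) λ i → ∀ j → j ≢ i → ∀ a b → F j a b ≡ 0ℤ
      pick (inj₂ _)  (inj₁ e₁) (inj₁ e₂) _ = 0F , λ { 0F 0≢0 → ⊥-elim (0≢0 refl) ; 1F _ → vanish e₁ ; 2F _ → vanish e₂ }
      pick (inj₁ e₀) (inj₂ _)  (inj₁ e₂) _ = 1F , λ { 0F _ → vanish e₀ ; 1F 1≢1 → ⊥-elim (1≢1 refl) ; 2F _ → vanish e₂ }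
      pick (inj₁ e₀) (inj₁ e₁) (inj₂ _)  _ = 2F , λ { 0F _ → vanish e₀ ; 1F _ → vanish e₁ ; 2F 2≢2 → ⊥-elim (2≢2 refl) }
      pick (inj₁ _)  (inj₁ _)  (inj₁ _)  ()
      pick (inj₂ _)  (inj₂ _)  (inj₁ _)  ()
      pick (inj₂ _)  (inj₁ _)  (inj₂ _)  ()
      pick (inj₁ _)  (inj₂ _)  (inj₂ _)  ()
      pick (inj₂ _)  (inj₂ _)  (inj₂ _)  ()

    private
      quadruple : (X : Fin n → Fin n → ℤ) → energy X ≡ E → energy (λ a b → X a b + X a b) ≡ E * + 4
      quadruple X energy≡E = trans (energy-double X) (trans (cong (+ 4 *_) energy≡E) (ℤₚ.*-comm (+ 4) E))

    double-not-binary : (X : Fin n → Fin n → ℤ) → energy X ≡ E → ¬ Binary (λ a b → X a b + X a b)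
    double-not-binary X energy≡E (inj₁ e≡0)
      with ℤₚ.*-cancelˡ-≡ E (+ 4) 0ℤ (trans (sym (quadruple X energy≡E)) (trans e≡0 (sym (ℤₚ.*-zeroʳ E))))
    ... | ()
    double-not-binary X energy≡E (inj₂ e≡E)
      with ℤₚ.*-cancelˡ-≡ E (+ 4) 1ℤ (trans (sym (quadruple X energy≡E)) (trans e≡E (sym (ℤₚ.*-identityʳ E))))
    ... | ()

module Flows where

  open import Data.Nat as ℕ using (ℕ; zero; suc; _∸_; NonZero)
  open import Data.Nat.DivMod using (_%_; n%n≡0; m*n%n≡0)
  import Data.Nat.Properties as ℕₚ
  open import Data.Integer using (ℤ; 0ℤ; 1ℤ; +_; _+_; _-_; -_; _*_)
  import Data.Integer.Properties as ℤₚ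
  open import Data.Integer.Tactic.RingSolver using (solve-∀)
  open import Data.Fin as Fin using (Fin; toℕ; _≟_)
  import Data.Fin.Properties as Finₚ
  open import Data.List using ([]; _∷_; map; tabulate)
  open import Data.List.Relation.Unary.All using (All; []; _∷_)
  open import Data.Product using (_×_; _,_; proj₂)
  open import Data.Sum using (_⊎_; inj₁; inj₂)
  open import Data.Empty using (⊥-elim)
  open import Function using (_∘_; id)
  open import Relation.Nullary using (yes; no; Dec)
  open import Relation.Binary.PropositionalEquality using (_≡_; _≢_; refl; sym; trans; cong; cong₂; subst; module ≡-Reasoning)
  open import Algebra.Properties.AbelianGroup ℤₚ.+-0-abelianGroup using (⁻¹-anti-homo‿-)
  open import Defs hiding (sym)
  open Summation
  open CyclicIndex
  open Energy

  module Flow (H : FGraph) where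

    private
      V : Set
      V = Fin (m H)

    arcSign : V → V → V → V → ℤ
    arcSign a b u v = δ H a b u v - δ H a b v u

    flow : ∀ {k} → (Fin k → V) → V → V → ℤ
    flow w a b = walkChain H w a b - walkChain H w b a

    segmentFlow : (ℕ → V) → V → V → ℕ → ℕ → ℤ
    segmentFlow U a b = rangeSum (λ t → arcSign a b (U t) (U (suc t)))

    δ-swap : ∀ (a b u v : V) → δ H a b u v ≡ δ H b a v u
    δ-swap a b u v with a ≟ u | b ≟ v
    ... | yes _ | yes _ = refl
    ... | yes _ | no _  = refl
    ... | no _  | yes _ = refl
    ... | no _  | no _  = refl

    arcSign-self : ∀ a b u → arcSign a b u u ≡ 0ℤ
    arcSign-self a b u = ℤₚ.+-inverseʳ (δ H a b u u)

    arcSign-reverse : ∀ a b u v → arcSign a b v u ≡ - arcSign a b u v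
    arcSign-reverse a b u v = sym (⁻¹-anti-homo‿- (δ H a b u v) (δ H a b v u))

    sumℤ-tabulate : ∀ {K k} (f : Fin k → ℤ) (i : Fin K → Fin k) → sumℤ H (map f (tabulate i)) ≡ sum (f ∘ i)
    sumℤ-tabulate {zero}  f i = refl
    sumℤ-tabulate {suc K} f i = cong (_+_ (f (i Fin.zero))) (sumℤ-tabulate f (i ∘ Fin.suc))

    flow-≡-sum : ∀ {k} (w : Fin k → V) a b → flow w a b ≡ sum (λ i → arcSign a b (w i) (w (next i)))
    flow-≡-sum w a b = begin
      walkChain H w a b - walkChain H w b a
        ≡⟨ cong₂ _-_ (sumℤ-tabulate (λ i → δ H a b (w i) (w (next i))) id)
                     (sumℤ-tabulate (λ i → δ H b a (w i) (w (next i))) id) ⟩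
      sum (λ i → δ H a b (w i) (w (next i))) - sum (λ i → δ H b a (w i) (w (next i)))
        ≡⟨ cong (λ t → sum (λ i → δ H a b (w i) (w (next i))) - t) (sum-cong-≗ (λ i → δ-swap b a (w i) (w (next i)))) ⟩
      sum (λ i → δ H a b (w i) (w (next i))) - sum (λ i → δ H a b (w (next i)) (w i))
        ≡⟨ sym (sum-minus (λ i → δ H a b (w i) (w (next i))) (λ i → δ H a b (w (next i)) (w i))) ⟩
      sum (λ i → arcSign a b (w i) (w (next i))) ∎
      where open ≡-Reasoning

    flow-antisym : ∀ {k} (w : Fin k → V) a b → flow w b a ≡ - flow w a b
    flow-antisym w a b = sym (⁻¹-anti-homo‿- (walkChain H w a b) (walkChain H w b a))

    flow-cong : ∀ {k} {w w′ : Fin k → V} → (∀ i → w i ≡ w′ i) → ∀ a b → flow w a b ≡ flow w′ a b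
    flow-cong {w = w} {w′} w≗w′ a b = trans (flow-≡-sum w a b)
      (trans (sum-cong-≗ (λ i → cong₂ (arcSign a b) (w≗w′ i) (w≗w′ (next i)))) (sym (flow-≡-sum w′ a b)))

    flow-≡-segmentFlow : ∀ {k} (w : Fin k → V) (U : ℕ → V) → (∀ i → U (toℕ i) ≡ w i) →
      (∀ i → U (suc (toℕ i)) ≡ w (next i)) → ∀ a b → flow w a b ≡ segmentFlow U a b 0 k
    flow-≡-segmentFlow w U U≡w U≡w∘next a b = trans (flow-≡-sum w a b)
      (sum≡rangeSum _ _ 0 (λ i → sym (cong₂ (arcSign a b) (U≡w i) (U≡w∘next i))))

    flow-≡-cyclic : ∀ {k} .{{_ : NonZero k}} (w : Fin k → V) a b → flow w a b ≡ segmentFlow (cyclic w) a b 0 k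
    flow-≡-cyclic w = flow-≡-segmentFlow w (cyclic w) (cyclic-toℕ w) (cyclic-suc-toℕ w)

    flow-reverse : ∀ {k} .{{_ : NonZero k}} (w : Fin k → V) a b → flow (w ∘ neg) a b ≡ - flow w a b
    flow-reverse {k} w a b = begin
      flow (w ∘ neg) a b                                ≡⟨ flow-≡-segmentFlow (w ∘ neg) U U-toℕ U-suc-toℕ a b ⟩
      rangeSum (λ t → arcSign a b (U t) (U (suc t))) 0 k
        ≡⟨ rangeSum-cong 0 k (λ t t<k → trans (arcSign-reverse a b (W (k ∸ suc t)) (W (k ∸ t)))
                                              (cong (λ t′ → - arcSign a b (W (k ∸ suc t)) (W t′)) (ℕₚ.+-∸-assoc 1 {k} {suc t} t<k))) ⟩
      rangeSum (λ t → - F (k ∸ suc t)) 0 k              ≡⟨ rangeSum-neg (λ t → F (k ∸ suc t)) 0 k ⟩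
      - rangeSum (λ t → F (k ∸ suc t)) 0 k              ≡⟨ cong -_ (rangeSum-reverse F k) ⟩
      - rangeSum F 0 k                                  ≡⟨ cong -_ (sym (flow-≡-cyclic w a b)) ⟩
      - flow w a b                                      ∎
      where
      open ≡-Reasoning
      W : ℕ → V
      W = cyclic w
      U : ℕ → V
      U t = W (k ∸ t)
      F : ℕ → ℤ
      F t = arcSign a b (W t) (W (suc t))
      U-toℕ : ∀ i → U (toℕ i) ≡ w (neg i)
      U-toℕ i = cyclic-≡ w (k ∸ toℕ i) (neg i) (sym (toℕ-neg i))
      U-suc-toℕ : ∀ i → U (suc (toℕ i)) ≡ w (neg (next i))
      U-suc-toℕ i = cyclic-≡ w (k ∸ suc (toℕ i)) (neg (next i)) (sym (trans (toℕ-neg (next i)) (by-position (suc-toℕ-<-or-≡ i))))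
        where
        by-position : suc (toℕ i) ℕ.< k ⊎ suc (toℕ i) ≡ k → (k ∸ toℕ (next i)) % k ≡ (k ∸ suc (toℕ i)) % k
        by-position (inj₁ lt)    = cong (λ t → (k ∸ t) % k) (toℕ-next-< i lt)
        by-position (inj₂ i-last) = begin
          (k ∸ toℕ (next i)) % k       ≡⟨ cong (λ t → (k ∸ t) % k) (toℕ-next-last i i-last) ⟩
          k % k                        ≡⟨ n%n≡0 k ⟩
          0                            ≡⟨ sym (m*n%n≡0 0 k) ⟩
          0 % k                        ≡⟨ cong (_% k) (sym (trans (cong (k ∸_) i-last) (ℕₚ.n∸n≡0 k))) ⟩
          (k ∸ suc (toℕ i)) % k        ∎

    segmentFlow-constant : ∀ (X : ℕ → V) a b n l .{{_ : NonZero l}} → (∀ i → i ℕ.< l → X (n ℕ.+ i) ≡ X n) →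
      segmentFlow X a b n l ≡ arcSign a b (X n) (X (n ℕ.+ l))
    segmentFlow-constant X a b n (suc zero)    constant =
      trans (ℤₚ.+-identityʳ _) (cong (λ t → arcSign a b (X n) (X t)) (ℕₚ.+-comm 1 n))
    segmentFlow-constant X a b n (suc (suc l)) constant = begin
      arcSign a b (X n) (X (suc n)) + segmentFlow X a b (suc n) (suc l)
        ≡⟨ cong₂ _+_ (trans (cong (arcSign a b (X n)) X₁≡X₀) (arcSign-self a b (X n)))
                     (segmentFlow-constant X a b (suc n) (suc l) (λ i lt →
                        trans (cong X (sym (ℕₚ.+-suc n i))) (trans (constant (suc i) (ℕ.s≤s lt)) (sym X₁≡X₀)))) ⟩
      0ℤ + arcSign a b (X (suc n)) (X (suc n ℕ.+ suc l))
        ≡⟨ ℤₚ.+-identityˡ _ ⟩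
      arcSign a b (X (suc n)) (X (suc n ℕ.+ suc l))
        ≡⟨ cong₂ (arcSign a b) X₁≡X₀ (cong X (sym (ℕₚ.+-suc n (suc l)))) ⟩
      arcSign a b (X n) (X (n ℕ.+ suc (suc l))) ∎
      where
      open ≡-Reasoning
      X₁≡X₀ : X (suc n) ≡ X n
      X₁≡X₀ = trans (cong X (sym (ℕₚ.+-comm n 1))) (constant 1 (ℕ.s≤s (ℕ.s≤s ℕ.z≤n)))

    module _ (U : ℕ → V) (n d : ℕ) (returns : U (n ℕ.+ d) ≡ U n) where

      loop : Fin d → V
      loop i = U (n ℕ.+ toℕ i)

      loop-next : ∀ i → U (n ℕ.+ suc (toℕ i)) ≡ loop (next i)
      loop-next i with suc-toℕ-<-or-≡ i
      ... | inj₁ lt = cong (λ t → U (n ℕ.+ t)) (sym (toℕ-next-< i lt))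
      ... | inj₂ eq = begin
        U (n ℕ.+ suc (toℕ i))       ≡⟨ cong (λ t → U (n ℕ.+ t)) eq ⟩
        U (n ℕ.+ d)                 ≡⟨ returns ⟩
        U n                         ≡⟨ cong U (sym (ℕₚ.+-identityʳ n)) ⟩
        U (n ℕ.+ 0)                 ≡⟨ cong (λ t → U (n ℕ.+ t)) (sym (toℕ-next-last i eq)) ⟩
        U (n ℕ.+ toℕ (next i))      ∎
        where open ≡-Reasoning

      loop-closed : (∀ t → Adj H (U t) (U (suc t))) → ClosedWalk H loop
      loop-closed adjacent i =
        subst (Adj H (loop i)) (trans (cong U (sym (ℕₚ.+-suc n (toℕ i)))) (loop-next i)) (adjacent (n ℕ.+ toℕ i))

      flow-loop : ∀ a b → flow loop a b ≡ segmentFlow U a b n d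
      flow-loop a b = trans (flow-≡-segmentFlow loop (λ t → U (n ℕ.+ t)) (λ _ → refl) loop-next a b)
        (trans (rangeSum-cong-≗ 0 d (λ t → cong (λ t′ → arcSign a b (U (n ℕ.+ t)) (U t′)) (ℕₚ.+-suc n t)))
               (rangeSum-shift (λ t → arcSign a b (U t) (U (suc t))) n d))

    δ≡indicator : ∀ (a b x y : V) → δ H a b x y ≡ indicator a x * indicator b y
    δ≡indicator a b x y with a ≟ x | b ≟ y
    ... | yes _ | yes _ = refl
    ... | yes _ | no _  = refl
    ... | no _  | yes _ = refl
    ... | no _  | no _  = refl

    δ≡1 : ∀ {a b x y : V} → a ≡ x → b ≡ y → δ H a b x y ≡ 1ℤ
    δ≡1 {a} {b} {x} {y} a≡x b≡y with a ≟ x | b ≟ y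
    ... | yes _ | yes _   = refl
    ... | no a≢x | _      = ⊥-elim (a≢x a≡x)
    ... | yes _ | no b≢y  = ⊥-elim (b≢y b≡y)

    δ≡0 : ∀ {a b x y : V} → a ≢ x ⊎ b ≢ y → δ H a b x y ≡ 0ℤ
    δ≡0 {a} {b} {x} {y} a≢x⊎b≢y with a ≟ x | b ≟ y | a≢x⊎b≢y
    ... | yes a≡x | yes _   | inj₁ a≢x = ⊥-elim (a≢x a≡x)
    ... | yes _   | yes b≡y | inj₂ b≢y = ⊥-elim (b≢y b≡y)
    ... | yes _   | no _    | _        = refl
    ... | no _    | _       | _        = refl

    sum²-δ : ∀ (G : V → V → ℤ) u v → sum (λ a → sum (λ b → G a b * δ H a b u v)) ≡ G u v
    sum²-δ G u v = begin
      sum (λ a → sum (λ b → G a b * δ H a b u v))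
        ≡⟨ sum-cong-≗ (λ a → sum-cong-≗ (λ b → trans (cong (G a b *_) (δ≡indicator a b u v)) (swap (G a b) (indicator a u) (indicator b v)))) ⟩
      sum (λ a → sum (λ b → indicator a u * (G a b * indicator b v)))
        ≡⟨ sum-cong-≗ (λ a → sym (*-distribˡ-sum (indicator a u) (λ b → G a b * indicator b v))) ⟩
      sum (λ a → indicator a u * sum (λ b → G a b * indicator b v))
        ≡⟨ sum-cong-≗ (λ a → trans (cong (indicator a u *_) (sum-indicator v (G a))) (ℤₚ.*-comm (indicator a u) (G a v))) ⟩
      sum (λ a → G a v * indicator a u)
        ≡⟨ sum-indicator u (λ a → G a v) ⟩
      G u v ∎
      where
      open ≡-Reasoning
      swap : ∀ x y z → x * (y * z) ≡ y * (x * z)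
      swap = solve-∀

    energy-flow : ∀ {k} (w : Fin k → V) → energy (flow w) ≡ sum (λ i → + 2 * flow w (w i) (w (next i)))
    energy-flow w = begin
      sum (λ a → sum (λ b → flow w a b * flow w a b))
        ≡⟨ sum-cong-≗ (λ a → sum-cong-≗ (λ b → trans (cong (flow w a b *_) (flow-≡-sum w a b))
                                                       (*-distribˡ-sum (flow w a b) (λ i → arcSign a b (w i) (w (next i)))))) ⟩
      sum (λ a → sum (λ b → sum (λ i → flow w a b * arcSign a b (w i) (w (next i)))))
        ≡⟨ sum-cong-≗ (λ a → ∑-comm (λ b i → flow w a b * arcSign a b (w i) (w (next i)))) ⟩
      sum (λ a → sum (λ i → sum (λ b → flow w a b * arcSign a b (w i) (w (next i)))))
        ≡⟨ ∑-comm (λ a i → sum (λ b → flow w a b * arcSign a b (w i) (w (next i)))) ⟩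
      sum (λ i → sum (λ a → sum (λ b → flow w a b * arcSign a b (w i) (w (next i)))))
        ≡⟨ sum-cong-≗ (λ i → pairing (w i) (w (next i))) ⟩
      sum (λ i → + 2 * flow w (w i) (w (next i))) ∎
      where
      open ≡-Reasoning
      pairing : ∀ u v → sum (λ a → sum (λ b → flow w a b * arcSign a b u v)) ≡ + 2 * flow w u v
      pairing u v = begin
        sum (λ a → sum (λ b → flow w a b * arcSign a b u v))
          ≡⟨ sum-cong-≗ (λ a → trans (sum-cong-≗ (λ b → distrib (flow w a b) _ _)) (sum-minus (forward a) (backward a))) ⟩
        sum (λ a → sum (forward a) - sum (backward a))
          ≡⟨ sum-minus (λ a → sum (forward a)) (λ a → sum (backward a)) ⟩
        sum (λ a → sum (forward a)) - sum (λ a → sum (backward a))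
          ≡⟨ cong₂ _-_ (sum²-δ (flow w) u v) (sum²-δ (flow w) v u) ⟩
        flow w u v - flow w v u
          ≡⟨ cong (λ t → flow w u v - t) (flow-antisym w u v) ⟩
        flow w u v - - flow w u v
          ≡⟨ double (flow w u v) ⟩
        + 2 * flow w u v ∎
        where
        forward backward : V → V → ℤ
        forward a b  = flow w a b * δ H a b u v
        backward a b = flow w a b * δ H a b v u
        distrib : ∀ x p q → x * (p - q) ≡ x * p - x * q
        distrib = solve-∀
        double : ∀ x → x - - x ≡ + 2 * x
        double = solve-∀

    injective-flow-along : ∀ {k} → 3 ℕ.≤ k → (w : Fin k → V) → (∀ i j → w i ≡ w j → i ≡ j) →
      ∀ i → flow w (w i) (w (next i)) ≡ 1ℤ
    injective-flow-along {k} k≥3 w injective i = begin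
      flow w c d                                        ≡⟨ flow-≡-sum w c d ⟩
      sum (λ j → arcSign c d (w j) (w (next j)))        ≡⟨ sum-cong-≗ (λ j → trans (term j) (sym (ℤₚ.*-identityˡ (indicator j i)))) ⟩
      sum (λ j → 1ℤ * indicator j i)                    ≡⟨ sum-indicator i (λ _ → 1ℤ) ⟩
      1ℤ                                                ∎
      where
      open ≡-Reasoning
      c d : V
      c = w i
      d = w (next i)
      term : ∀ j → arcSign c d (w j) (w (next j)) ≡ indicator j i
      term j with j ≟ i
      ... | yes refl = cong₂ _-_ (δ≡1 {c} {d} refl refl) (δ≡0 {c} {d} (inj₁ c≢d))
        where
        c≢d : c ≢ d
        c≢d c≡d = next≢id (ℕₚ.≤-trans (ℕ.s≤s (ℕ.s≤s ℕ.z≤n)) k≥3) j (sym (injective _ _ c≡d))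
      ... | no  j≢i = cong₂ _-_ (δ≡0 (inj₁ (λ c≡wj → j≢i (sym (injective _ _ c≡wj))))) backwards
        where
        backwards : δ H c d (w (next j)) (w j) ≡ 0ℤ
        backwards = δ≡0 (by-cases (c ≟ w (next j)))
          where
          by-cases : Dec (c ≡ w (next j)) → c ≢ w (next j) ⊎ d ≢ w j
          by-cases (no  c≢) = inj₁ c≢
          by-cases (yes c≡) = inj₂ (λ d≡wj → next²≢id k≥3 i (trans (cong next (injective _ _ d≡wj)) (sym (injective _ _ c≡))))

    energy-injective : ∀ {k} → 3 ℕ.≤ k → (w : Fin k → V) → (∀ i j → w i ≡ w j → i ≡ j) → energy (flow w) ≡ + (2 ℕ.* k)
    energy-injective {k} k≥3 w injective = begin
      energy (flow w)                              ≡⟨ energy-flow w ⟩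
      sum (λ i → + 2 * flow w (w i) (w (next i)))  ≡⟨ sum-cong-≗ (λ i → cong (+ 2 *_) (injective-flow-along k≥3 w injective i)) ⟩
      sum {k} (λ _ → + 2)                          ≡⟨ sum-const k (+ 2) ⟩
      + k * + 2                                    ≡⟨ sym (ℤₚ.pos-* k 2) ⟩
      + (k ℕ.* 2)                                  ≡⟨ cong +_ (ℕₚ.*-comm k 2) ⟩
      + (2 ℕ.* k)                                  ∎
      where open ≡-Reasoning

    module TriangleFreeFlow (triangle-free : TriangleFree H) where

      EqOrAdj-sym : ∀ {x y} → EqOrAdj H x y → EqOrAdj H y x
      EqOrAdj-sym (inj₁ eq)  = inj₁ (sym eq)
      EqOrAdj-sym (inj₂ adj) = inj₂ (FGraph.sym H adj)

      degenerate : ∀ {x y z} → EqOrAdj H x y → EqOrAdj H y z → EqOrAdj H x z → x ≡ y ⊎ y ≡ z ⊎ x ≡ z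
      degenerate {x} {y} {z} xy yz xz with x ≟ y | y ≟ z | x ≟ z
      ... | yes x≡y | _       | _       = inj₁ x≡y
      ... | no _    | yes y≡z | _       = inj₂ (inj₁ y≡z)
      ... | no _    | no _    | yes x≡z = inj₂ (inj₂ x≡z)
      ... | no x≢y  | no y≢z  | no x≢z  =
        ⊥-elim (triangle-free x y z x≢y y≢z x≢z (adjacent xy x≢y) (adjacent yz y≢z) (adjacent xz x≢z))
        where
        adjacent : ∀ {u v} → EqOrAdj H u v → u ≢ v → Adj H u v
        adjacent (inj₁ eq)  u≢v = ⊥-elim (u≢v eq)
        adjacent (inj₂ adj) _   = adj

      arcSign-cocycle : ∀ a b {x y z} → EqOrAdj H x y → EqOrAdj H y z → EqOrAdj H x z →
        arcSign a b x y + arcSign a b y z + arcSign a b z x ≡ 0ℤ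
      arcSign-cocycle a b {x} {y} {z} xy yz xz with degenerate xy yz xz
      ... | inj₁ refl rewrite arcSign-self a b x | arcSign-reverse a b x z = cancel (arcSign a b x z)
        where cancel : ∀ s → 0ℤ + s + - s ≡ 0ℤ
              cancel = solve-∀
      ... | inj₂ (inj₁ refl) rewrite arcSign-self a b y | arcSign-reverse a b x y = cancel (arcSign a b x y)
        where cancel : ∀ s → s + 0ℤ + - s ≡ 0ℤ
              cancel = solve-∀
      ... | inj₂ (inj₂ refl) rewrite arcSign-self a b x | arcSign-reverse a b x y = cancel (arcSign a b x y)
        where cancel : ∀ s → s + - s + 0ℤ ≡ 0ℤ
              cancel = solve-∀

      -- the square x x′ y′ y together with its diagonal x y′
      Square : V → V → V → V → Set
      Square x x′ y y′ = EqOrAdj H x x′ × EqOrAdj H x′ y′ × EqOrAdj H x y′ × EqOrAdj H y y′ × EqOrAdj H x y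

      arcSign-square : ∀ a b {x x′ y y′} → Square x x′ y y′ →
        arcSign a b x x′ - arcSign a b y y′ ≡ arcSign a b y′ x′ - arcSign a b y x
      arcSign-square a b {x} {x′} {y} {y′} (xx′ , x′y′ , xy′ , yy′ , xy) = begin
        s x x′ - s y y′      ≡⟨ cong (λ t → s x x′ - t) (arcSign-reverse a b y′ y) ⟩
        s x x′ - - s y′ y    ≡⟨ rearrange (s x x′) (s x′ y′) (s x y′) (s y′ y) (s y x) upper lower ⟩
        - s x′ y′ - s y x    ≡⟨ cong (_- s y x) (sym (arcSign-reverse a b x′ y′)) ⟩
        s y′ x′ - s y x      ∎
        where
        open ≡-Reasoning
        s : V → V → ℤ
        s = arcSign a b
        upper : s x x′ + s x′ y′ + - s x y′ ≡ 0ℤ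
        upper = trans (cong (_+_ (s x x′ + s x′ y′)) (sym (arcSign-reverse a b x y′))) (arcSign-cocycle a b xx′ x′y′ xy′)
        lower : s x y′ + s y′ y + s y x ≡ 0ℤ
        lower = arcSign-cocycle a b xy′ (EqOrAdj-sym yy′) xy
        rearrange : ∀ p q r t u → p + q + - r ≡ 0ℤ → r + t + u ≡ 0ℤ → p - - t ≡ - q - u
        rearrange p q r t u h₁ h₂ = begin
          p - - t                                   ≡⟨ expand p q r t u ⟩
          (p + q + - r) + (r + t + u) + (- q - u)   ≡⟨ cong₂ (λ c c′ → c + c′ + (- q - u)) h₁ h₂ ⟩
          0ℤ + 0ℤ + (- q - u)                       ≡⟨ ℤₚ.+-identityˡ (- q - u) ⟩
          - q - u                                   ∎
          where
          expand : ∀ p q r t u → p - - t ≡ (p + q + - r) + (r + t + u) + (- q - u)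
          expand = solve-∀

      flow-homotopy : ∀ {k} (w w′ : Fin k → V) → (∀ i → Square (w i) (w (next i)) (w′ i) (w′ (next i))) →
        ∀ a b → flow w a b ≡ flow w′ a b
      flow-homotopy {k} w w′ squares a b = ℤₚ.i-j≡0⇒i≡j _ _ (begin
        flow w a b - flow w′ a b
          ≡⟨ cong₂ _-_ (flow-≡-sum w a b) (flow-≡-sum w′ a b) ⟩
        sum (λ i → s (w i) (w (next i))) - sum (λ i → s (w′ i) (w′ (next i)))
          ≡⟨ sym (sum-minus (λ i → s (w i) (w (next i))) (λ i → s (w′ i) (w′ (next i)))) ⟩
        sum (λ i → s (w i) (w (next i)) - s (w′ i) (w′ (next i)))
          ≡⟨ sum-cong-≗ (λ i → arcSign-square a b (squares i)) ⟩
        sum (λ i → rung (next i) - rung i)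
          ≡⟨ sum-minus (rung ∘ next) rung ⟩
        sum (rung ∘ next) - sum rung
          ≡⟨ cong (_- sum rung) (sum-next rung) ⟩
        sum rung - sum rung
          ≡⟨ ℤₚ.+-inverseʳ (sum rung) ⟩
        0ℤ ∎)
        where
        open ≡-Reasoning
        s : V → V → ℤ
        s = arcSign a b
        rung : Fin k → ℤ
        rung i = s (w′ i) (w i)

      ∂₂-symmetric : ∀ (L : Chain₂ H) → All (λ e → ValidSimplex₂ H (proj₂ e)) L → ∀ a b → ∂₂ H L a b ≡ ∂₂ H L b a
      ∂₂-symmetric []                         []                 a b = refl
      ∂₂-symmetric ((c , (x , y , z)) ∷ L) ((xy , yz , xz) ∷ valid) a b =
        cong₂ _+_ (cong (c *_) (face-symmetric (degenerate xy yz xz))) (∂₂-symmetric L valid a b)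
        where
        δ₁ δ₂ : V → V → ℤ
        δ₁ = δ H a b
        δ₂ = δ H b a
        face-symmetric : x ≡ y ⊎ y ≡ z ⊎ x ≡ z → (δ₁ y z - δ₁ x z) + δ₁ x y ≡ (δ₂ y z - δ₂ x z) + δ₂ x y
        face-symmetric (inj₁ refl) =
          trans (cancel (δ₁ x z) (δ₁ x x)) (trans (δ-swap a b x x) (sym (cancel (δ₂ x z) (δ₂ x x))))
          where cancel : ∀ p q → (p - p) + q ≡ q
                cancel = solve-∀
        face-symmetric (inj₂ (inj₁ refl)) =
          trans (cancel (δ₁ y y) (δ₁ x y)) (trans (δ-swap a b y y) (sym (cancel (δ₂ y y) (δ₂ x y))))
          where cancel : ∀ q p → (q - p) + p ≡ q
                cancel = solve-∀
        face-symmetric (inj₂ (inj₂ refl)) rewrite δ-swap b a y x | δ-swap b a x y | δ-swap b a x x =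
          swap (δ₁ y x) (δ₁ x x) (δ₁ x y)
          where swap : ∀ u v w → (u - v) + w ≡ (w - v) + u
                swap = solve-∀

      boundary-symmetric : ∀ χ → IsBoundary H χ → ∀ a b → χ a b ≡ χ b a
      boundary-symmetric χ (L , valid , χ≡∂L) a b = trans (χ≡∂L a b) (trans (∂₂-symmetric L valid a b) (sym (χ≡∂L b a)))

      homologous⇒flow≡ : ∀ {k₁ k₂} (w₁ : Fin k₁ → V) (w₂ : Fin k₂ → V) → Homologous H w₁ w₂ →
        ∀ a b → flow w₁ a b ≡ flow w₂ a b
      homologous⇒flow≡ w₁ w₂ w₁~w₂ a b =
        regroup (walkChain H w₁ a b) (walkChain H w₂ a b) (walkChain H w₁ b a) (walkChain H w₂ b a)
                (boundary-symmetric _ w₁~w₂ a b)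
        where
        regroup : ∀ x y u v → x - y ≡ u - v → x - u ≡ y - v
        regroup x y u v eq = begin
          x - u                        ≡⟨ expand x y u v ⟩
          (x - y) + (y - v) - (u - v)  ≡⟨ cong (λ t → t + (y - v) - (u - v)) eq ⟩
          (u - v) + (y - v) - (u - v)  ≡⟨ collapse y u v ⟩
          y - v                        ∎
          where
          open ≡-Reasoning
          expand : ∀ x y u v → x - u ≡ (x - y) + (y - v) - (u - v)
          expand = solve-∀
          collapse : ∀ y u v → (u - v) + (y - v) - (u - v) ≡ y - v
          collapse = solve-∀

      nullHomologous⇒flow≡0 : ∀ {k} (w : Fin k → V) → NullHomologous H w → ∀ a b → flow w a b ≡ 0ℤ
      nullHomologous⇒flow≡0 w w-null a b =
        trans (cong (_- walkChain H w b a) (boundary-symmetric (walkChain H w) w-null a b))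
              (ℤₚ.+-inverseʳ (walkChain H w b a))

      short-closedWalk-flow≡0 : ∀ {g} → NoShorterNontrivial H g → ∀ {k} (w : Fin k → V) → ClosedWalk H w →
        k ℕ.< g → ∀ a b → flow w a b ≡ 0ℤ
      short-closedWalk-flow≡0 {g} shortest {k} w closed k<g a b with flow w a b ℤₚ.≟ 0ℤ
      ... | yes flow≡0 = flow≡0
      ... | no  flow≢0 = ⊥-elim (ℕₚ.<⇒≱ k<g (shortest k w closed (λ null → flow≢0 (nullHomologous⇒flow≡0 w null a b))))

      -- The repetition splits w into two closed walks shorter than g, both of flow 0.
      repeated-vertex-flow≡0 : ∀ {g} .{{_ : NonZero g}} → NoShorterNontrivial H g → (w : Fin g → V) → ClosedWalk H w →
        ∀ i j → toℕ i ℕ.< toℕ j → w i ≡ w j → ∀ a b → flow w a b ≡ 0ℤ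
      repeated-vertex-flow≡0 {g} shortest w closed i j i<j wi≡wj a b = begin
        flow w a b                                      ≡⟨ flow-≡-cyclic w a b ⟩
        segmentFlow W a b 0 g                           ≡⟨ rangeSum-rotate F g I F-periodic I≤g ⟩
        segmentFlow W a b I g                           ≡⟨ cong (segmentFlow W a b I) (sym (ℕₚ.m+[n∸m]≡n d≤g)) ⟩
        segmentFlow W a b I (d ℕ.+ (g ℕ.∸ d))           ≡⟨ rangeSum-split F I d (g ℕ.∸ d) ⟩
        segmentFlow W a b I d + segmentFlow W a b (I ℕ.+ d) (g ℕ.∸ d)
                                                        ≡⟨ cong₂ _+_ inner-flow≡0 outer-flow≡0 ⟩
        0ℤ                                              ∎
        where
        open ≡-Reasoning
        W : ℕ → V
        W = cyclic w
        F : ℕ → ℤ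
        F t = arcSign a b (W t) (W (suc t))
        I J d : ℕ
        I = toℕ i
        J = toℕ j
        d = J ℕ.∸ I
        F-periodic : ∀ t → F (t ℕ.+ g) ≡ F t
        F-periodic t = cong₂ (arcSign a b) (cyclic-+ w t) (cyclic-+ w (suc t))
        steps : ∀ t → Adj H (W t) (W (suc t))
        steps = cyclic-steps w (Adj H) closed
        I≤g : I ℕ.≤ g
        I≤g = ℕₚ.<⇒≤ (ℕₚ.<-trans i<j (Finₚ.toℕ<n j))
        d≤g : d ℕ.≤ g
        d≤g = ℕₚ.≤-trans (ℕₚ.m∸n≤m J I) (ℕₚ.<⇒≤ (Finₚ.toℕ<n j))
        d<g : d ℕ.< g
        d<g = ℕₚ.≤-<-trans (ℕₚ.m∸n≤m J I) (Finₚ.toℕ<n j)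
        g∸d<g : g ℕ.∸ d ℕ.< g
        g∸d<g = ℕₚ.∸-monoʳ-< {m = g} {n = d} {o = 0} (ℕₚ.m<n⇒0<n∸m i<j) d≤g
        I+d≡J : I ℕ.+ d ≡ J
        I+d≡J = ℕₚ.m+[n∸m]≡n (ℕₚ.<⇒≤ i<j)
        WJ≡WI : W J ≡ W I
        WJ≡WI = trans (cyclic-toℕ w j) (trans (sym wi≡wj) (sym (cyclic-toℕ w i)))
        inner-returns : W (I ℕ.+ d) ≡ W I
        inner-returns = trans (cong W I+d≡J) WJ≡WI
        outer-returns : W (J ℕ.+ (g ℕ.∸ d)) ≡ W J
        outer-returns = begin
          W (J ℕ.+ (g ℕ.∸ d))          ≡⟨ cong (λ t → W (t ℕ.+ (g ℕ.∸ d))) (sym I+d≡J) ⟩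
          W (I ℕ.+ d ℕ.+ (g ℕ.∸ d))    ≡⟨ cong W (trans (ℕₚ.+-assoc I d (g ℕ.∸ d)) (cong (I ℕ.+_) (ℕₚ.m+[n∸m]≡n d≤g))) ⟩
          W (I ℕ.+ g)                  ≡⟨ cyclic-+ w I ⟩
          W I                          ≡⟨ sym WJ≡WI ⟩
          W J                          ∎
        inner-flow≡0 : segmentFlow W a b I d ≡ 0ℤ
        inner-flow≡0 = trans (sym (flow-loop W I d inner-returns a b))
          (short-closedWalk-flow≡0 shortest _ (loop-closed W I d inner-returns steps) d<g a b)
        outer-flow≡0 : segmentFlow W a b (I ℕ.+ d) (g ℕ.∸ d) ≡ 0ℤ
        outer-flow≡0 = trans (cong (λ t → segmentFlow W a b t (g ℕ.∸ d)) I+d≡J) (trans (sym (flow-loop W J (g ℕ.∸ d) outer-returns a b))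
          (short-closedWalk-flow≡0 shortest _ (loop-closed W J (g ℕ.∸ d) outer-returns steps) g∸d<g a b))

      energy-dichotomy : ∀ {g} .{{_ : NonZero g}} → 3 ℕ.≤ g → NoShorterNontrivial H g → (w : Fin g → V) → ClosedWalk H w →
        energy (flow w) ≡ 0ℤ ⊎ energy (flow w) ≡ + (2 ℕ.* g)
      energy-dichotomy g≥3 shortest w closed with injective⊎collision w
      ... | inj₁ injective = inj₂ (energy-injective g≥3 w injective)
      ... | inj₂ (i , j , i<j , wi≡wj) = inj₁ (sum-zero _ (λ a → sum-zero _ (λ b →
              cong (λ x → x * x) (repeated-vertex-flow≡0 shortest w closed i j i<j wi≡wj a b))))

module SumGadgets where

  open import Data.Nat as ℕ using (ℕ; zero; suc; _+_; _*_; _<_; _≤_; NonZero; pred)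
  import Data.Nat.Properties as ℕₚ
  open import Data.Fin as Fin using (Fin; toℕ; fromℕ; fromℕ<; inject₁)
  import Data.Fin.Properties as Finₚ
  open import Data.Product using (_,_)
  open import Data.Sum using (inj₁; inj₂)
  open import Function using (_∘_)
  open import Relation.Binary.PropositionalEquality using (_≡_; refl; sym; trans; cong; subst; subst₂; module ≡-Reasoning)
  open import Defs hiding (sym)
  open Summation
  open CyclicIndex
  open Flows

  ≡-along-path : ∀ {A : Set} n (G : Fin (suc n) → A) → (∀ (p : Fin n) → G (inject₁ p) ≡ G (Fin.suc p)) →
    G Fin.zero ≡ G (fromℕ n)
  ≡-along-path zero    G steps = refl
  ≡-along-path (suc n) G steps = trans (≡-along-path n (G ∘ inject₁) (steps ∘ inject₁)) (steps (fromℕ n))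

  index-< : ∀ {m n} j i → j < m → i < n → j * n + i < m * n
  index-< {m} {n} j i j<m i<n = begin-strict
    j * n + i     <⟨ ℕₚ.+-monoʳ-< (j * n) i<n ⟩
    j * n + n     ≡⟨ ℕₚ.+-comm (j * n) n ⟩
    suc j * n     ≤⟨ ℕₚ.*-monoˡ-≤ n j<m ⟩
    m * n         ∎
    where open ℕₚ.≤-Reasoning

  module SumGadget (H : FGraph) (triangle-free : TriangleFree H) {s g ℓ : ℕ} .{{_ : NonZero s}} .{{_ : NonZero g}}
    (φ : SV s g ℓ → Fin (m H))
    (φ-ident : ∀ {x y} → SIdent x y → φ x ≡ φ y)
    (φ-edge : ∀ {x y} → SEdge x y → Adj H (φ x) (φ y)) where

    open Flow H
    open TriangleFreeFlow triangle-free

    private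
      V : Set
      V = Fin (m H)

      instance
        sg≢0 : NonZero (s * g)
        sg≢0 = ℕₚ.m*n≢0 s g

      slice : Fin (suc ℓ) → Fin (s * g) → V
      slice p b = φ (pb p b)

      top bottom : ℕ → V
      top    = cyclic (slice (fromℕ ℓ))
      bottom = cyclic (slice Fin.zero)

      top-index : ∀ j i → j < g → i < s → j * s + i < s * g
      top-index j i j<g i<s = subst (j * s + i <_) (ℕₚ.*-comm g s) (index-< j i j<g i<s)

      bottom-index : ∀ i j → i < s → j < g → i * g + j < s * g
      bottom-index = index-<

      top-block : ∀ j i → j < g → i < s → top (j * s + i) ≡ top (j * s)
      top-block j i j<g i<s = begin
        top (j * s + i)               ≡⟨ cyclic-at (slice (fromℕ ℓ)) (fromℕ< lt) (Finₚ.toℕ-fromℕ< lt) ⟩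
        slice (fromℕ ℓ) (fromℕ< lt)   ≡⟨ φ-ident (zid (fromℕ< j<g) (fromℕ< i<s) (fromℕ< 0<s) _ _ index index₀) ⟩
        slice (fromℕ ℓ) (fromℕ< lt₀)  ≡⟨ cyclic-at (slice (fromℕ ℓ)) (fromℕ< lt₀) (Finₚ.toℕ-fromℕ< lt₀) ⟨
        top (j * s + 0)               ≡⟨ cong top (ℕₚ.+-identityʳ (j * s)) ⟩
        top (j * s)                   ∎
        where
        open ≡-Reasoning
        0<s : 0 < s
        0<s = ℕ.>-nonZero⁻¹ s
        lt : j * s + i < s * g
        lt  = top-index j i j<g i<s
        lt₀ : j * s + 0 < s * g
        lt₀ = top-index j 0 j<g 0<s
        index : toℕ (fromℕ< lt) ≡ toℕ (fromℕ< j<g) * s + toℕ (fromℕ< i<s)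
        index rewrite Finₚ.toℕ-fromℕ< lt | Finₚ.toℕ-fromℕ< j<g | Finₚ.toℕ-fromℕ< i<s = refl
        index₀ : toℕ (fromℕ< lt₀) ≡ toℕ (fromℕ< j<g) * s + toℕ (fromℕ< 0<s)
        index₀ rewrite Finₚ.toℕ-fromℕ< lt₀ | Finₚ.toℕ-fromℕ< j<g | Finₚ.toℕ-fromℕ< 0<s = refl

    zWalk : Fin g → V
    zWalk j = top (toℕ j * s)

    aWalk : Fin s → Fin g → V
    aWalk i j = φ (aVert i j)

    zWalk-≡ : (Z : Fin g → V) → (∀ {j x} → SZVertex j x → φ x ≡ Z j) → ∀ j → zWalk j ≡ Z j
    zWalk-≡ Z Z-matches j = begin
      top (toℕ j * s)                ≡⟨ cong top (sym (ℕₚ.+-identityʳ (toℕ j * s))) ⟩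
      top (toℕ j * s + 0)            ≡⟨ cyclic-at (slice (fromℕ ℓ)) (fromℕ< lt) (Finₚ.toℕ-fromℕ< lt) ⟩
      slice (fromℕ ℓ) (fromℕ< lt)    ≡⟨ Z-matches (zv (fromℕ< 0<s) (fromℕ< lt) index) ⟩
      Z j                            ∎
      where
      open ≡-Reasoning
      0<s : 0 < s
      0<s = ℕ.>-nonZero⁻¹ s
      lt : toℕ j * s + 0 < s * g
      lt  = top-index (toℕ j) 0 (Finₚ.toℕ<n j) 0<s
      index : toℕ (fromℕ< lt) ≡ toℕ j * s + toℕ (fromℕ< 0<s)
      index rewrite Finₚ.toℕ-fromℕ< lt | Finₚ.toℕ-fromℕ< 0<s = refl

    private
      top-next : ∀ u → top (suc (toℕ u) * s) ≡ zWalk (next u)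
      top-next u with suc-toℕ-<-or-≡ u
      ... | inj₁ lt     = cong (λ t → top (t * s)) (sym (toℕ-next-< u lt))
      ... | inj₂ u-last = begin
        top (suc (toℕ u) * s)     ≡⟨ cong (λ t → top (t * s)) u-last ⟩
        top (g * s)               ≡⟨ cong top (ℕₚ.*-comm g s) ⟩
        top (0 + s * g)           ≡⟨ cyclic-+ (slice (fromℕ ℓ)) 0 ⟩
        top 0                     ≡⟨ cong (λ t → top (t * s)) (sym (toℕ-next-last u u-last)) ⟩
        zWalk (next u)            ∎
        where open ≡-Reasoning

    zWalk-closed : ClosedWalk H zWalk
    zWalk-closed u = subst₂ (Adj H) block-last block-after (top-steps (toℕ u * s + pred s))
      where
      top-steps : ∀ t → Adj H (top t) (top (suc t))
      top-steps = cyclic-steps (slice (fromℕ ℓ)) (Adj H) (λ b → φ-edge (prodE (PathAdj-refl _) (CycAdj-next b)))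
      block-last : top (toℕ u * s + pred s) ≡ zWalk u
      block-last = top-block (toℕ u) (pred s) (Finₚ.toℕ<n u) (subst (pred s <_) (ℕₚ.suc-pred s) (ℕₚ.n<1+n (pred s)))
      block-after : top (suc (toℕ u * s + pred s)) ≡ zWalk (next u)
      block-after = trans (cong top (begin
        suc (toℕ u * s + pred s)   ≡⟨ ℕₚ.+-suc (toℕ u * s) (pred s) ⟨
        toℕ u * s + suc (pred s)   ≡⟨ cong (toℕ u * s +_) (ℕₚ.suc-pred s) ⟩
        toℕ u * s + s              ≡⟨ ℕₚ.+-comm (toℕ u * s) s ⟩
        suc (toℕ u) * s            ∎)) (top-next u)
        where open ≡-Reasoning

    private
      bottom-start : ∀ i → i ≤ s → bottom (i * g) ≡ bottom 0
      bottom-start i i≤s with ℕₚ.m≤n⇒m<n∨m≡n i≤s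
      ... | inj₂ refl = cyclic-+ (slice Fin.zero) 0
      ... | inj₁ i<s  = begin
        bottom (i * g)                  ≡⟨ cyclic-at (slice Fin.zero) (fromℕ< lt) (Finₚ.toℕ-fromℕ< lt) ⟩
        slice Fin.zero (fromℕ< lt)      ≡⟨ φ-ident (aid (fromℕ< i<s) (fromℕ< 0<s) (fromℕ< lt) (fromℕ< lt₀) index index₀) ⟩
        slice Fin.zero (fromℕ< lt₀)     ≡⟨ cyclic-at (slice Fin.zero) (fromℕ< lt₀) (Finₚ.toℕ-fromℕ< lt₀) ⟨
        bottom 0                        ∎
        where
        open ≡-Reasoning
        0<s : 0 < s
        0<s = ℕ.>-nonZero⁻¹ s
        lt : i * g < s * g
        lt  = subst (_< s * g) (ℕₚ.+-identityʳ (i * g)) (bottom-index i 0 i<s (ℕ.>-nonZero⁻¹ g))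
        lt₀ : 0 < s * g
        lt₀ = bottom-index 0 0 0<s (ℕ.>-nonZero⁻¹ g)
        index : toℕ (fromℕ< lt) ≡ toℕ (fromℕ< i<s) * g
        index rewrite Finₚ.toℕ-fromℕ< lt | Finₚ.toℕ-fromℕ< i<s = refl
        index₀ : toℕ (fromℕ< lt₀) ≡ toℕ (fromℕ< 0<s) * g
        index₀ rewrite Finₚ.toℕ-fromℕ< lt₀ | Finₚ.toℕ-fromℕ< 0<s = refl

      bottom-returns : ∀ i → i < s → bottom (i * g + g) ≡ bottom (i * g)
      bottom-returns i i<s =
        trans (cong bottom (ℕₚ.+-comm (i * g) g)) (trans (bottom-start (suc i) i<s) (sym (bottom-start i (ℕₚ.<⇒≤ i<s))))

      bottom-glue : ∀ (i : Fin s) u → bottom (toℕ i * g + toℕ u) ≡ φ (ax i Fin.zero u)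
      bottom-glue i u = trans (cyclic-at (slice Fin.zero) (fromℕ< lt) (Finₚ.toℕ-fromℕ< lt))
                              (sym (φ-ident (glue i u (fromℕ< lt) (Finₚ.toℕ-fromℕ< lt))))
        where
        lt : toℕ i * g + toℕ u < s * g
        lt = bottom-index (toℕ i) (toℕ u) (Finₚ.toℕ<n i) (Finₚ.toℕ<n u)

      edge : ∀ {x y} → SEdge x y → EqOrAdj H (φ x) (φ y)
      edge x~y = inj₂ (φ-edge x~y)

      flow-slices : ∀ a b → flow (slice Fin.zero) a b ≡ flow (slice (fromℕ ℓ)) a b
      flow-slices a b = ≡-along-path ℓ (λ p → flow (slice p) a b) (λ p → flow-homotopy (slice (inject₁ p)) (slice (Fin.suc p))
        (λ u → edge (prodE (PathAdj-refl _) (CycAdj-next u)) , edge (prodE (PathAdj-inject₁-suc p) (CycAdj-refl (next u))) ,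
               edge (prodE (PathAdj-inject₁-suc p) (CycAdj-next u)) , edge (prodE (PathAdj-refl _) (CycAdj-next u)) ,
               edge (prodE (PathAdj-inject₁-suc p) (CycAdj-refl u))) a b)

      flow-prism : ∀ (i : Fin s) a b → flow (λ u → φ (ax i Fin.zero u)) a b ≡ flow (aWalk i) a b
      flow-prism i = flow-homotopy (λ u → φ (ax i Fin.zero u)) (aWalk i)
        (λ u → edge (axE (CycAdj-next u)) , edge (axE (CycAdj-refl (next u))) , edge (axE (CycAdj-next u)) ,
               edge (axE (CycAdj-next u)) , edge (axE (CycAdj-refl u)))

      flow-top : ∀ a b → flow (slice (fromℕ ℓ)) a b ≡ flow zWalk a b
      flow-top a b = begin
        flow (slice (fromℕ ℓ)) a b                                  ≡⟨ flow-≡-cyclic (slice (fromℕ ℓ)) a b ⟩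
        segmentFlow top a b 0 (s * g)                               ≡⟨ cong (segmentFlow top a b 0) (ℕₚ.*-comm s g) ⟩
        segmentFlow top a b 0 (g * s)                               ≡⟨ rangeSum-blocks _ 0 g s ⟩
        rangeSum (λ j → segmentFlow top a b (j * s) s) 0 g          ≡⟨ rangeSum-cong 0 g block ⟩
        rangeSum (λ j → arcSign a b (top (j * s)) (top (suc j * s))) 0 g
                                                                    ≡⟨ flow-≡-segmentFlow zWalk (λ j → top (j * s)) (λ _ → refl) top-next a b ⟨
        flow zWalk a b                                              ∎
        where
        open ≡-Reasoning
        block : ∀ j → j < g → segmentFlow top a b (j * s) s ≡ arcSign a b (top (j * s)) (top (suc j * s))
        block j j<g = trans (segmentFlow-constant top a b (j * s) s (λ i i<s → top-block j i j<g i<s))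
                            (cong (λ t → arcSign a b (top (j * s)) (top t)) (ℕₚ.+-comm (j * s) s))

      flow-bottom : ∀ a b → flow (slice Fin.zero) a b ≡ sum (λ i → flow (aWalk i) a b)
      flow-bottom a b = begin
        flow (slice Fin.zero) a b                                   ≡⟨ flow-≡-cyclic (slice Fin.zero) a b ⟩
        segmentFlow bottom a b 0 (s * g)                            ≡⟨ rangeSum-blocks _ 0 s g ⟩
        rangeSum (λ i → segmentFlow bottom a b (i * g) g) 0 s       ≡⟨ sum≡rangeSum _ _ 0 block ⟨
        sum (λ i → flow (aWalk i) a b)                              ∎
        where
        open ≡-Reasoning
        block : ∀ (i : Fin s) → flow (aWalk i) a b ≡ segmentFlow bottom a b (toℕ i * g) g
        block i = begin
          flow (aWalk i) a b                                       ≡⟨ flow-prism i a b ⟨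
          flow (λ u → φ (ax i Fin.zero u)) a b                     ≡⟨ flow-cong (λ u → sym (bottom-glue i u)) a b ⟩
          flow (loop bottom (toℕ i * g) g returns) a b             ≡⟨ flow-loop bottom (toℕ i * g) g returns a b ⟩
          segmentFlow bottom a b (toℕ i * g) g                     ∎
          where
          returns : bottom (toℕ i * g + g) ≡ bottom (toℕ i * g)
          returns = bottom-returns (toℕ i) (Finₚ.toℕ<n i)

    flow-zWalk : ∀ a b → flow zWalk a b ≡ sum (λ i → flow (aWalk i) a b)
    flow-zWalk a b = trans (sym (flow-top a b)) (trans (sym (flow-slices a b)) (flow-bottom a b))

module ForwardDirection where

  open import Data.Nat as ℕ using (ℕ; zero; suc; _+_; _*_)
  import Data.Nat.Properties as ℕₚ
  open import Data.Fin as Fin using (Fin; toℕ; fromℕ; _≟_; _<_)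
  import Data.Fin.Properties as Finₚ
  open import Data.Product using (_×_; _,_; proj₁; proj₂)
  open import Data.Sum using (inj₁; inj₂)
  open import Data.Empty using (⊥-elim)
  open import Data.List using ([])
  open import Data.List.Relation.Unary.All using ([])
  import Data.Integer.Properties as ℤₚ
  open import Function using (id)
  open import Relation.Nullary using (yes; no)
  open import Relation.Binary.PropositionalEquality using (_≡_; _≢_; refl; sym; trans; cong; ≢-sym)
  open import Defs hiding (sym)
  open CyclicIndex

  collapse : ∀ {n g} → Fin n → Fin n → Fin (suc g) → Fin (suc g)
  collapse i k j with i ≟ k
  ... | yes _ = j
  ... | no _  = Fin.zero

  module _ {n g : ℕ} {i k : Fin n} where

    collapse-≡ : i ≡ k → ∀ (j : Fin (suc g)) → collapse i k j ≡ j
    collapse-≡ i≡k j with i ≟ k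
    ... | yes _   = refl
    ... | no i≢k  = ⊥-elim (i≢k i≡k)

    collapse-≢ : i ≢ k → ∀ (j : Fin (suc g)) → collapse i k j ≡ Fin.zero
    collapse-≢ i≢k j with i ≟ k
    ... | yes i≡k = ⊥-elim (i≢k i≡k)
    ... | no _    = refl

    collapse-zero : collapse i k (Fin.zero {g}) ≡ Fin.zero
    collapse-zero with i ≟ k
    ... | yes _ = refl
    ... | no _  = refl

    collapse-CycAdj : ∀ {j j′ : Fin (suc g)} → CycAdj j j′ → CycAdj (collapse i k j) (collapse i k j′)
    collapse-CycAdj j~j′ with i ≟ k
    ... | yes _ = j~j′
    ... | no _  = CycAdj-refl Fin.zero

  module Forward (H : FGraph) (reflexive : Reflexive H) {g : ℕ} (z : Fin (suc g) → Fin (m H)) (z-cycle : IsCycle H z) where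

    private
      V : Set
      V = Fin (m H)

    z-CycAdj : ∀ {a b} → CycAdj a b → Adj H (z a) (z b)
    z-CycAdj {a} {b} a~b with CycAdj⇒next a~b
    ... | inj₁ refl        = proj₁ z-cycle a
    ... | inj₂ (inj₁ refl) = FGraph.sym H (proj₁ z-cycle b)
    ... | inj₂ (inj₂ refl) = reflexive (z a)

    module ActiveGadget {s ℓ : ℕ} (valid : ValidL s (suc g) ℓ) (k : Fin s) (σ : Fin (suc g) → Fin (suc g))
      (σ-CycAdj : ∀ {a b} → CycAdj a b → CycAdj (σ a) (σ b)) (σ-zero : σ Fin.zero ≡ Fin.zero) where

      private
        h : Fin (suc ℓ) → Fin (s * suc g) → Fin (suc g)
        h = proj₁ (proj₂ valid k)
        h-hom : ∀ p p′ b b′ → PathAdj p p′ → CycAdj b b′ → CycAdj (h p b) (h p′ b′)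
        h-hom = proj₁ (proj₂ (proj₂ valid k))
        h-bottom : ∀ (i : Fin s) (j : Fin (suc g)) b → toℕ b ≡ toℕ i * suc g + toℕ j →
                   (i ≡ k → toℕ (h Fin.zero b) ≡ toℕ j) × (i ≢ k → toℕ (h Fin.zero b) ≡ 0)
        h-bottom = proj₁ (proj₂ (proj₂ (proj₂ valid k)))
        h-top : ∀ (j : Fin (suc g)) (i : Fin s) b → toℕ b ≡ toℕ j * s + toℕ i → toℕ (h (fromℕ ℓ) b) ≡ toℕ j
        h-top = proj₁ (proj₂ (proj₂ (proj₂ (proj₂ valid k))))
        h-column : ∀ p b → toℕ b ≡ 0 → toℕ (h p b) ≡ 0
        h-column = proj₂ (proj₂ (proj₂ (proj₂ (proj₂ valid k))))

        h-bottom-collapse : ∀ i j b → toℕ b ≡ toℕ i * suc g + toℕ j → h Fin.zero b ≡ collapse i k j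
        h-bottom-collapse i j b index with i ≟ k
        ... | yes i≡k = Finₚ.toℕ-injective (proj₁ (h-bottom i j b index) i≡k)
        ... | no  i≢k = Finₚ.toℕ-injective (proj₂ (h-bottom i j b index) i≢k)

        z∘σ-zero : ∀ {j} → j ≡ Fin.zero → z (σ j) ≡ z Fin.zero
        z∘σ-zero refl = cong z σ-zero

      map : SV s (suc g) ℓ → V
      map (pb p b)   = z (σ (h p b))
      map (ax i _ j) = z (σ (collapse i k j))

      map-ident : ∀ {x y} → SIdent x y → map x ≡ map y
      map-ident (zid j i i′ b b′ index index′) =
        cong (λ t → z (σ t)) (Finₚ.toℕ-injective (trans (h-top j i b index) (sym (h-top j i′ b′ index′))))
      map-ident (aid i i′ b b′ index index′) =
        trans (z∘σ-zero (trans (h-bottom-collapse i Fin.zero b (trans index (sym (ℕₚ.+-identityʳ _)))) collapse-zero))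
              (sym (z∘σ-zero (trans (h-bottom-collapse i′ Fin.zero b′ (trans index′ (sym (ℕₚ.+-identityʳ _)))) collapse-zero)))
      map-ident (glue i j b index) = cong (λ t → z (σ t)) (sym (h-bottom-collapse i j b index))

      map-edge : ∀ {x y} → SEdge x y → Adj H (map x) (map y)
      map-edge (prodE {p} {p′} {b} {b′} p~p′ b~b′) = z-CycAdj (σ-CycAdj (h-hom p p′ b b′ p~p′ b~b′))
      map-edge (axE j~j′) = z-CycAdj (σ-CycAdj (collapse-CycAdj j~j′))

      map-Z : ∀ {j x} → SZVertex j x → map x ≡ z (σ j)
      map-Z {j} (zv i b index) = cong (λ t → z (σ t)) (Finₚ.toℕ-injective (h-top j i b index))

      map-T : ∀ {x} → InT x → map x ≡ z Fin.zero
      map-T (tP p b b≡0) = z∘σ-zero (Finₚ.toℕ-injective (h-column p b b≡0))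
      map-T (tA i j j≡0) = z∘σ-zero (trans (cong (collapse i k) (Finₚ.toℕ-injective j≡0)) collapse-zero)

    module Colouring (G : SGraph) {ℓ₂ ℓ₃ : ℕ} (valid₂ : ValidL 2 (suc g) ℓ₂) (valid₃ : ValidL 3 (suc g) ℓ₃)
      (c : Fin (n G) → Fin 3) (c-proper : K3Hom G c) where

      open Sharp G (suc g) ℓ₂ ℓ₃

      private
        neg-zero : neg (Fin.zero {g}) ≡ Fin.zero
        neg-zero = Finₚ.toℕ-injective (toℕ-neg-0 Fin.zero refl)

        module First    = ActiveGadget valid₂ Fin.zero id id refl
        module Second   = ActiveGadget valid₂ (Fin.suc Fin.zero) id id refl
        module Reversed = ActiveGadget valid₂ (Fin.suc Fin.zero) neg neg-CycAdj neg-zero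
        module Vertex (v : Fin (n G)) = ActiveGadget valid₃ (c v) id id refl

      data Choice : Set where
        first second reversed idle : Choice

      choiceMap : Choice → SV 2 (suc g) ℓ₂ → V
      choiceMap first    = First.map
      choiceMap second   = Second.map
      choiceMap reversed = Reversed.map
      choiceMap idle     = λ _ → z Fin.zero

      choiceMap-ident : ∀ ch {x y} → SIdent x y → choiceMap ch x ≡ choiceMap ch y
      choiceMap-ident first    = First.map-ident
      choiceMap-ident second   = Second.map-ident
      choiceMap-ident reversed = Reversed.map-ident
      choiceMap-ident idle     = λ _ → refl

      choiceMap-edge : ∀ ch {x y} → SEdge x y → Adj H (choiceMap ch x) (choiceMap ch y)
      choiceMap-edge first    = First.map-edge
      choiceMap-edge second   = Second.map-edge
      choiceMap-edge reversed = Reversed.map-edge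
      choiceMap-edge idle     = λ _ → reflexive (z Fin.zero)

      choiceMap-T : ∀ ch {x} → InT x → choiceMap ch x ≡ z Fin.zero
      choiceMap-T first    = First.map-T
      choiceMap-T second   = Second.map-T
      choiceMap-T reversed = Reversed.map-T
      choiceMap-T idle     = λ _ → refl

      -- S^v_{i,j} : A_0 follows A^v_i, and A_1 follows A^v_j read backwards
      pairChoice : Fin 3 → Fin 3 → Fin 3 → Choice
      pairChoice cv i j with cv ≟ i | cv ≟ j
      ... | yes _ | _     = first
      ... | no _  | yes _ = reversed
      ... | no _  | no _  = idle

      edgeChoice : Fin 3 → Fin 3 → Fin 3 → Choice
      edgeChoice cu cv i with cu ≟ i | cv ≟ i
      ... | yes _ | _     = first
      ... | no _  | yes _ = second
      ... | no _  | no _  = idle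

      pair-A₀ : ∀ cv i j k → choiceMap (pairChoice cv i j) (aVert Fin.zero k) ≡ z (collapse i cv k)
      pair-A₀ cv i j k with cv ≟ i | cv ≟ j
      ... | yes cv≡i | _     = cong z (sym (collapse-≡ (sym cv≡i) k))
      ... | no cv≢i  | yes _ = cong z (trans neg-zero (sym (collapse-≢ (≢-sym cv≢i) k)))
      ... | no cv≢i  | no _  = cong z (sym (collapse-≢ (≢-sym cv≢i) k))

      pair-A₁ : ∀ cv i j → i < j → ∀ k → choiceMap (pairChoice cv i j) (aVert (Fin.suc Fin.zero) k) ≡ z (collapse j cv (neg k))
      pair-A₁ cv i j i<j k with cv ≟ i | cv ≟ j
      ... | yes refl | _        = cong z (sym (collapse-≢ (λ j≡i → Finₚ.<-irrefl (sym j≡i) i<j) (neg k)))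
      ... | no _     | yes cv≡j = cong z (sym (collapse-≡ (sym cv≡j) (neg k)))
      ... | no _     | no cv≢j  = cong z (sym (collapse-≢ (≢-sym cv≢j) (neg k)))

      edge-A₀ : ∀ cu cv i k → choiceMap (edgeChoice cu cv i) (aVert Fin.zero k) ≡ z (collapse i cu k)
      edge-A₀ cu cv i k with cu ≟ i | cv ≟ i
      ... | yes cu≡i | _     = cong z (sym (collapse-≡ (sym cu≡i) k))
      ... | no cu≢i  | yes _ = cong z (sym (collapse-≢ (≢-sym cu≢i) k))
      ... | no cu≢i  | no _  = cong z (sym (collapse-≢ (≢-sym cu≢i) k))

      edge-A₁ : ∀ cu cv i → cu ≢ cv → ∀ k → choiceMap (edgeChoice cu cv i) (aVert (Fin.suc Fin.zero) k) ≡ z (collapse i cv k)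
      edge-A₁ cu cv i cu≢cv k with cu ≟ i | cv ≟ i
      ... | yes refl | _        = cong z (sym (collapse-≢ cu≢cv k))
      ... | no _     | yes cv≡i = cong z (sym (collapse-≡ (sym cv≡i) k))
      ... | no _     | no cv≢i  = cong z (sym (collapse-≢ (≢-sym cv≢i) k))

      hom : GV → V
      hom (aV v i j)            = z (collapse i (c v) j)
      hom (zV j)                = z j
      hom (s3V v x)             = Vertex.map v x
      hom (pairV v i j _ x)     = choiceMap (pairChoice (c v) i j) x
      hom (edgeV u v _ _ i x)   = choiceMap (edgeChoice (c u) (c v) i) x

      hom-ident : ∀ x y → GIdent x y → hom x ≡ hom y
      hom-ident _ _ (inS3 {v} x~y)                 = Vertex.map-ident v x~y
      hom-ident _ _ (inPair {v} {i} {j} x~y)       = choiceMap-ident (pairChoice (c v) i j) x~y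
      hom-ident _ _ (inEdge {u} {v} {i = i} x~y)   = choiceMap-ident (edgeChoice (c u) (c v) i) x~y
      hom-ident _ _ (s3Z {v} j x∈Z)                = Vertex.map-Z v x∈Z
      hom-ident _ _ (s3A v i j)                    = refl
      hom-ident _ _ (pairA0 v i j i<j k)           = pair-A₀ (c v) i j k
      hom-ident _ _ (pairA1 v i j i<j k)           = pair-A₁ (c v) i j i<j k
      hom-ident _ _ (edgeA0 u v u<v uv i k)        = edge-A₀ (c u) (c v) i k
      hom-ident _ _ (edgeA1 u v u<v uv i k)        = edge-A₁ (c u) (c v) i (c-proper u v uv) k

      hom-edge : ∀ x y → GEdge x y → Adj H (hom x) (hom y)
      hom-edge _ _ (aE j~j′)                       = z-CycAdj (collapse-CycAdj j~j′)
      hom-edge _ _ (zE j~j′)                       = z-CycAdj j~j′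
      hom-edge _ _ (s3E {v} x~y)                   = Vertex.map-edge v x~y
      hom-edge _ _ (pairE {v} {i} {j} x~y)         = choiceMap-edge (pairChoice (c v) i j) x~y
      hom-edge _ _ (edgeE {u} {v} {i = i} x~y)     = choiceMap-edge (edgeChoice (c u) (c v) i) x~y

      hom-T : ∀ x → InTStar x → hom x ≡ z Fin.zero
      hom-T _ (tS3 {v} x∈T)                        = Vertex.map-T v x∈T
      hom-T _ (tPair {v} {i} {j} x∈T)              = choiceMap-T (pairChoice (c v) i j) x∈T
      hom-T _ (tEdge {u} {v} {i = i} x∈T)          = choiceMap-T (edgeChoice (c u) (c v) i) x∈T

      hom-isHom : IsHom H hom
      hom-isHom = hom-ident , hom-edge

      hom-hitsCopy : HitsCopy H hom
      hom-hitsCopy = z , z-cycle , [] , [] , λ a b → ℤₚ.+-inverseʳ (walkChain H z a b)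

      hom-zeroOnT* : ZeroOnT* H z hom
      hom-zeroOnT* x x∈T* j j≡0 = trans (hom-T x x∈T*) (cong z (Finₚ.toℕ-injective (sym j≡0)))

module BackwardDirection where

  open import Data.Nat as ℕ using (ℕ; NonZero)
  import Data.Nat.Properties as ℕₚ
  open import Data.Integer as ℤ using (ℤ; 0ℤ; +_; _+_; _-_; -_)
  import Data.Integer.Properties as ℤₚ
  open import Data.Integer.Tactic.RingSolver using (solve-∀)
  open import Data.Fin as Fin using (Fin; _<_)
  import Data.Fin.Properties as Finₚ
  open import Data.Fin.Patterns using (0F; 1F; 2F)
  open import Data.Bool using (T)
  open import Data.Product using (Σ; _,_; proj₁; proj₂)
  open import Data.Empty using (⊥)
  open import Relation.Binary using (tri<; tri≈; tri>)
  open import Relation.Binary.PropositionalEquality using (_≡_; _≢_; refl; sym; trans; cong; cong₂; subst; module ≡-Reasoning)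
  open import Defs hiding (sym)
  open Summation
  open CyclicIndex
  open Energy
  open Flows
  open SumGadgets

  sum₃-single : ∀ (x : Fin 3 → ℤ) i → (∀ j → j ≢ i → x j ≡ 0ℤ) → x 0F + x 1F + x 2F ≡ x i
  sum₃-single x 0F others rewrite others 1F (λ ()) | others 2F (λ ()) = trans (ℤₚ.+-identityʳ (x 0F + 0ℤ)) (ℤₚ.+-identityʳ (x 0F))
  sum₃-single x 1F others rewrite others 0F (λ ()) | others 2F (λ ()) = trans (ℤₚ.+-identityʳ (0ℤ + x 1F)) (ℤₚ.+-identityˡ (x 1F))
  sum₃-single x 2F others rewrite others 0F (λ ()) | others 1F (λ ()) = ℤₚ.+-identityˡ (x 2F)

  module Backward (H : FGraph) (triangle-free : TriangleFree H) {g : ℕ} .{{_ : NonZero g}} (g≥3 : 3 ℕ.≤ g)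
    (shortest : NoShorterNontrivial H g) (G : SGraph) {ℓ₂ ℓ₃ : ℕ}
    (f : Sharp.GV G g ℓ₂ ℓ₃ → Fin (m H)) (f-hom : Sharp.IsHom G g ℓ₂ ℓ₃ H f) (f-hits : Sharp.HitsCopy G g ℓ₂ ℓ₃ H f) where

    open Sharp G g ℓ₂ ℓ₃
    open Flow H
    open TriangleFreeFlow triangle-free

    private
      V : Set
      V = Fin (m H)

      f-ident : ∀ x y → GIdent x y → f x ≡ f y
      f-ident = proj₁ f-hom

      f-edge : ∀ x y → GEdge x y → Adj H (f x) (f y)
      f-edge = proj₂ f-hom

      E : ℤ
      E = + (2 ℕ.* g)

      instance
        E≢0 : ℤ.NonZero E
        E≢0 = ℕₚ.m*n≢0 2 g

    Z* : Fin g → V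
    Z* j = f (zV j)

    A : Fin (n G) → Fin 3 → Fin g → V
    A v i j = f (aV v i j)

    energy-Z* : energy (flow Z*) ≡ E
    energy-Z* = let (C , C-cycle , Z*~C) = f-hits in
      trans (energy-cong (homologous⇒flow≡ Z* C Z*~C)) (energy-injective g≥3 C (proj₂ C-cycle))

    binary : (w : Fin g → V) → ClosedWalk H w → Binary E (flow w)
    binary = energy-dichotomy g≥3 shortest

    A-closed : ∀ v i → ClosedWalk H (A v i)
    A-closed v i j = f-edge _ _ (aE (CycAdj-next j))

    module VertexGadget (v : Fin (n G)) =
      SumGadget H triangle-free (λ x → f (s3V v x)) (λ x~y → f-ident _ _ (inS3 x~y)) (λ x~y → f-edge _ _ (s3E x~y))
    module PairGadget (v : Fin (n G)) (i j : Fin 3) (i<j : i < j) =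
      SumGadget H triangle-free (λ x → f (pairV v i j i<j x)) (λ x~y → f-ident _ _ (inPair x~y)) (λ x~y → f-edge _ _ (pairE x~y))
    module EdgeGadget (u v : Fin (n G)) (u<v : u < v) (uv : T (adj G u v)) (i : Fin 3) =
      SumGadget H triangle-free (λ x → f (edgeV u v u<v uv i x)) (λ x~y → f-ident _ _ (inEdge x~y)) (λ x~y → f-edge _ _ (edgeE x~y))

    flow-Z*-vertex : ∀ v a b → flow Z* a b ≡ flow (A v 0F) a b + flow (A v 1F) a b + flow (A v 2F) a b
    flow-Z*-vertex v a b = begin
      flow Z* a b                      ≡⟨ flow-cong (λ j → sym (zWalk-≡ Z* (λ {j} x∈Z → f-ident _ _ (s3Z j x∈Z)) j)) a b ⟩
      flow zWalk a b                   ≡⟨ flow-zWalk a b ⟩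
      sum (λ i → flow (aWalk i) a b)   ≡⟨ sum-cong-≗ (λ i → flow-cong (λ j → f-ident _ _ (s3A v i j)) a b) ⟩
      flow (A v 0F) a b + (flow (A v 1F) a b + (flow (A v 2F) a b + 0ℤ))
                                       ≡⟨ regroup (flow (A v 0F) a b) (flow (A v 1F) a b) (flow (A v 2F) a b) ⟩
      flow (A v 0F) a b + flow (A v 1F) a b + flow (A v 2F) a b ∎
      where
      open ≡-Reasoning
      open VertexGadget v
      regroup : ∀ x y z → x + (y + (z + 0ℤ)) ≡ x + y + z
      regroup = solve-∀

    flow-pair : ∀ v i j (i<j : i < j) a b → flow (PairGadget.zWalk v i j i<j) a b ≡ flow (A v i) a b - flow (A v j) a b
    flow-pair v i j i<j a b = begin
      flow zWalk a b                                     ≡⟨ flow-zWalk a b ⟩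
      flow (aWalk 0F) a b + (flow (aWalk 1F) a b + 0ℤ)   ≡⟨ cong₂ (λ x y → x + (y + 0ℤ)) first second ⟩
      flow (A v i) a b + (- flow (A v j) a b + 0ℤ)       ≡⟨ cong (_+_ (flow (A v i) a b)) (ℤₚ.+-identityʳ _) ⟩
      flow (A v i) a b - flow (A v j) a b                ∎
      where
      open ≡-Reasoning
      open PairGadget v i j i<j
      first : flow (aWalk 0F) a b ≡ flow (A v i) a b
      first = flow-cong (λ k → f-ident _ _ (pairA0 v i j i<j k)) a b
      second : flow (aWalk 1F) a b ≡ - flow (A v j) a b
      second = trans (flow-cong (λ k → f-ident _ _ (pairA1 v i j i<j k)) a b) (flow-reverse (A v j) a b)

    flow-edge : ∀ u v (u<v : u < v) uv i a b → flow (EdgeGadget.zWalk u v u<v uv i) a b ≡ flow (A u i) a b + flow (A v i) a b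
    flow-edge u v u<v uv i a b = begin
      flow zWalk a b                                     ≡⟨ flow-zWalk a b ⟩
      flow (aWalk 0F) a b + (flow (aWalk 1F) a b + 0ℤ)   ≡⟨ cong₂ (λ x y → x + (y + 0ℤ)) first second ⟩
      flow (A u i) a b + (flow (A v i) a b + 0ℤ)         ≡⟨ cong (_+_ (flow (A u i) a b)) (ℤₚ.+-identityʳ _) ⟩
      flow (A u i) a b + flow (A v i) a b                ∎
      where
      open ≡-Reasoning
      open EdgeGadget u v u<v uv i
      first : flow (aWalk 0F) a b ≡ flow (A u i) a b
      first = flow-cong (λ k → f-ident _ _ (edgeA0 u v u<v uv i k)) a b
      second : flow (aWalk 1F) a b ≡ flow (A v i) a b
      second = flow-cong (λ k → f-ident _ _ (edgeA1 u v u<v uv i k)) a b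

    Carries : Fin (n G) → Fin 3 → Set
    Carries v i = ∀ j → j ≢ i → ∀ a b → flow (A v j) a b ≡ 0ℤ

    -- opaque, so that comparing colours never unfolds the decision procedures hidden in carrier
    opaque
      carrier : ∀ v → Σ (Fin 3) (Carries v)
      carrier v = all-but-one-vanish E (λ i → flow (A v i))
        (trans (energy-cong (λ a b → sym (flow-Z*-vertex v a b))) energy-Z*)
        (λ i → binary (A v i) (A-closed v i))
        (λ i j i<j → Binary-cong E (flow-pair v i j i<j) (binary _ (PairGadget.zWalk-closed v i j i<j)))

    carries⇒flow≡ : ∀ {v i} → Carries v i → ∀ a b → flow (A v i) a b ≡ flow Z* a b
    carries⇒flow≡ {v} {i} carries a b =
      trans (sym (sum₃-single (λ j → flow (A v j) a b) i (λ j j≢i → carries j j≢i a b))) (sym (flow-Z*-vertex v a b))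

    colour : Fin (n G) → Fin 3
    colour v = proj₁ (carrier v)

    -- Both A^u_i and A^v_i would carry the class of Z*, so the gadget S^{uv}_i would see it twice.
    same-carrier-on-edge : ∀ u v (u<v : u < v) (uv : T (adj G u v)) i → Carries u i → Carries v i → ⊥
    same-carrier-on-edge u v u<v uv i u-carries v-carries =
      double-not-binary E (flow Z*) energy-Z*
        (Binary-cong E (λ a b → trans (flow-edge u v u<v uv i a b)
                                       (cong₂ _+_ (carries⇒flow≡ u-carries a b) (carries⇒flow≡ v-carries a b)))
                       (binary _ (EdgeGadget.zWalk-closed u v u<v uv i)))

    colour-proper : K3Hom G colour
    colour-proper u v uv same with Finₚ.<-cmp u v
    ... | tri< u<v _ _ = same-carrier-on-edge u v u<v uv (colour u) (proj₂ (carrier u)) (subst (Carries v) (sym same) (proj₂ (carrier v)))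
    ... | tri≈ _ refl _ = subst T (irrefl G u) uv
    ... | tri> _ _ v<u = same-carrier-on-edge v u v<u (subst T (adjSym G u v) uv) (colour v) (proj₂ (carrier v))
                                               (subst (Carries u) same (proj₂ (carrier u)))


open import Defs
open import Data.Nat using (ℕ; _≤_)
open import Data.Fin using (Fin)
open import Data.Product using (Σ; _×_)
open import Relation.Nullary using (¬_)

open import Data.Nat using (suc; s≤s)
import Data.Nat.Properties as ℕₚ
open import Data.Product using (_,_; proj₁; proj₂)
open ForwardDirection
open BackwardDirection

lemma6p4 : (H : FGraph) → Reflexive H → Connected H → TriangleFree H →
  (g : ℕ) → 4 ≤ g → (z : Fin g → Fin (m H)) → IsCycle H z →
  ¬ NullHomologous H z → NoShorterNontrivial H g →
  (ℓ₂ ℓ₃ : ℕ) → ValidL 2 g ℓ₂ → ValidL 3 g ℓ₃ →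
  (G : SGraph) →
    ((Σ (Fin (n G) → Fin 3) λ φ → K3Hom G φ) →
       Σ (Sharp.GV G g ℓ₂ ℓ₃ → Fin (m H)) λ f →
         Sharp.IsHom G g ℓ₂ ℓ₃ H f × Sharp.HitsCopy G g ℓ₂ ℓ₃ H f)
  × ((Σ (Sharp.GV G g ℓ₂ ℓ₃ → Fin (m H)) λ f →
         Sharp.IsHom G g ℓ₂ ℓ₃ H f × Sharp.HitsCopy G g ℓ₂ ℓ₃ H f) →
       Σ (Fin (n G) → Fin 3) λ φ → K3Hom G φ)
  × ((Σ (Sharp.GV G g ℓ₂ ℓ₃ → Fin (m H)) λ f →
         Sharp.IsHom G g ℓ₂ ℓ₃ H f × Sharp.HitsCopy G g ℓ₂ ℓ₃ H f) →
       Σ (Sharp.GV G g ℓ₂ ℓ₃ → Fin (m H)) λ f →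
         Sharp.IsHom G g ℓ₂ ℓ₃ H f × Sharp.HitsCopy G g ℓ₂ ℓ₃ H f
           × Sharp.ZeroOnT* G g ℓ₂ ℓ₃ H z f)
lemma6p4 H reflexive _ triangle-free (suc g) (s≤s g≥3) z z-cycle _ shortest ℓ₂ ℓ₃ valid₂ valid₃ G =
  (λ (c , c-proper) → let open Realise c c-proper in hom , hom-isHom , hom-hitsCopy) ,
  colouring ,
  (λ φ* → let open Realise (proj₁ (colouring φ*)) (proj₂ (colouring φ*)) in hom , hom-isHom , hom-hitsCopy , hom-zeroOnT*)
  where
  module Realise = Forward.Colouring H reflexive z z-cycle G valid₂ valid₃

  colouring : (Σ (Sharp.GV G (suc g) ℓ₂ ℓ₃ → Fin (m H)) λ f →
                 Sharp.IsHom G (suc g) ℓ₂ ℓ₃ H f × Sharp.HitsCopy G (suc g) ℓ₂ ℓ₃ H f) →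
              Σ (Fin (n G) → Fin 3) λ c → K3Hom G c
  colouring (f , f-hom , f-hits) = colour , colour-proper
    where open Backward H triangle-free (ℕₚ.m≤n⇒m≤1+n g≥3) shortest G f f-hom f-hits
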